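{- Let $\mathcal{D}$ be the set of all Dyck paths. For $D\in\mathcal{D}$ and $i\ge1$ let $\mathrm{sp}_i(D)$ (resp. $\mathrm{ap}_i(D)$) be the number of symmetric (resp. asymmetric) peaks of weight $i$ in $D$, and let $|D|$ be the semilength of $D$. Let $\mathbf{t}=(t_1,t_2,\dots)$, $\mathbf{r}=(r_1,r_2,\dots)$ be formal variables, and for $\mathbf{x}=(x_1,x_2,\dots)$ put $P(\mathbf{x},z)=\sum_{i\ge1}x_iz^i$. Then $$\sum_{D\in\mathcal{D}}\Big(\prod_{i\ge1}t_i^{\mathrm{sp}_i(D)}r_i^{\mathrm{ap}_i(D)}\Big)z^{|D|} =\frac{1+z-(1+z)P(\mathbf{t},z)+2zP(\mathbf{r},z)-\sqrt{(1-z)\big[(1-P(\mathbf{t},z))^2-z(1-P(\mathbf{t},z)+2P(\mathbf{r},z))^2\big]}}{2z\,(1-P(\mathbf{t},z)+P(\mathbf{r},z))^2}.$$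
   Context: A Dyck path of semilength $n$ is a lattice path with steps $\mathbf{u}=(1,1)$ and $\mathbf{d}=(1,-1)$ from $(0,0)$ to $(2n,0)$ never going below the $x$-axis. A peak is an occurrence of consecutive steps $\mathbf{ud}$. Every peak extends to a unique maximal consecutive subsequence $\mathbf{u}^i\mathbf{d}^j$ ($i,j\ge 1$), its maximal mountain; the peak is symmetric if $i=j$ and asymmetric otherwise, and its weight is $\min\{i,j\}$. -}

module Defs where

open import Level using (Level)
open import Data.Bool using (Bool; true; false; _∧_; not; if_then_else_)
open import Data.Nat using (ℕ; zero; suc; _∸_; _≡ᵇ_; _⊓_; _≤ᵇ_) renaming (_*_ to _*ℕ_)
open import Data.Product using (_×_; _,_)
open import Data.List using (List; []; _∷_; map; _++_; foldr; length; filterᵇ)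
open import Algebra.Bundles using (CommutativeRing)

data Step : Set where
  U D : Step   -- U = up step (1,1), D = down step (1,-1)

words : ℕ → List (List Step)
words zero    = [] ∷ []
words (suc k) = map (U ∷_) (words k) ++ map (D ∷_) (words k)

-- Starting at height h, the path stays weakly above the x-axis and ends at height 0
dyckFrom : ℕ → List Step → Bool
dyckFrom zero    []      = true
dyckFrom (suc h) []      = false
dyckFrom h       (U ∷ w) = dyckFrom (suc h) w
dyckFrom zero    (D ∷ w) = false
dyckFrom (suc h) (D ∷ w) = dyckFrom h w

isDyck : List Step → Bool
isDyck = dyckFrom zero

dyckPaths : ℕ → List (List Step)
dyckPaths n = filterᵇ isDyck (words (2 *ℕ n))

stepEq : Step → Step → Bool
stepEq U U = true
stepEq D D = true
stepEq _ _ = false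

pushRun : Step → List (Step × ℕ) → List (Step × ℕ)
pushRun s []               = (s , 1) ∷ []
pushRun s ((s' , k) ∷ rs) = if stepEq s s' then (s , suc k) ∷ rs else (s , 1) ∷ (s' , k) ∷ rs

runs : List Step → List (Step × ℕ)
runs []      = []
runs (s ∷ w) = pushRun s (runs w)

-- Every peak ud lies between a maximal U-run u^i and the immediately
-- following maximal D-run d^j; u^i d^j is its maximal mountain.
-- mountainsOfRuns lists the pairs (i , j), one per peak.
mountainsOfRuns : List (Step × ℕ) → List (ℕ × ℕ)
mountainsOfRuns ((U , i) ∷ (D , j) ∷ rs) = (i , j) ∷ mountainsOfRuns ((D , j) ∷ rs)
mountainsOfRuns (_ ∷ rs)                 = mountainsOfRuns rs
mountainsOfRuns []                       = []

mountains : List Step → List (ℕ × ℕ)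
mountains w = mountainsOfRuns (runs w)

count : {A : Set} → (A → Bool) → List A → ℕ
count p xs = length (filterᵇ p xs)

sp : ℕ → List Step → ℕ
sp k w = count (λ { (i , j) → (i ≡ᵇ j) ∧ (i ≡ᵇ k) }) (mountains w)

ap : ℕ → List Step → ℕ
ap k w = count (λ { (i , j) → not (i ≡ᵇ j) ∧ ((i ⊓ j) ≡ᵇ k) }) (mountains w)

-- Formal power series in z over a commutative ring R
-- (the formal variables t_i, r_i are interpreted in an arbitrary
--  commutative ring R in which 2 is invertible)

module Series {c ℓ : Level} (R : CommutativeRing c ℓ) where
  open CommutativeRing R

  Ser : Set c
  Ser = ℕ → Carrier

  _≋_ : Ser → Ser → Set ℓ
  f ≋ g = (n : ℕ) → f n ≈ g n

  pow : Carrier → ℕ → Carrier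
  pow x zero    = 1#
  pow x (suc k) = pow x k * x

  sumN : (ℕ → Carrier) → ℕ → Carrier
  sumN f zero    = 0#
  sumN f (suc n) = sumN f n + f n

  prodFrom1 : (ℕ → Carrier) → ℕ → Carrier
  prodFrom1 f zero    = 1#
  prodFrom1 f (suc n) = prodFrom1 f n * f (suc n)

  sumList : List Carrier → Carrier
  sumList = foldr _+_ 0#

  const : Carrier → Ser
  const a zero    = a
  const a (suc n) = 0#

  z : Ser
  z (suc zero) = 1#
  z _          = 0#

  _⊕_ : Ser → Ser → Ser
  (f ⊕ g) n = f n + g n

  _⊖_ : Ser → Ser → Ser
  (f ⊖ g) n = f n - g n

  _⊛_ : Ser → Ser → Ser
  (f ⊛ g) n = sumN (λ k → f k * g (n ∸ k)) (suc n)

  infixl 6 _⊕_ _⊖_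
  infixl 7 _⊛_

  -- division by z of a series with zero constant term
  divZ : Ser → Ser
  divZ f n = f (suc n)

  -- multiplicative inverse of a series A with A 0 = 1:
  -- B 0 = 1,  B m = - Σ_{k=1}^{m} A k * B (m - k)
  invP : Ser → ℕ → Ser
  invP A zero    k = 1#
  invP A (suc n) k =
    if k ≤ᵇ n then invP A n k
    else - sumN (λ j → A (suc j) * invP A n (suc n ∸ suc j)) (suc n)

  inv : Ser → Ser
  inv A n = invP A n n

  -- the square root with constant term 1 of a series Δ with Δ 0 = 1,
  -- given h with 2 h = 1:
  -- S 0 = 1,  S m = h * (Δ m - Σ_{k=1}^{m-1} S k * S (m - k))
  sqrtP : Carrier → Ser → ℕ → Ser
  sqrtP h Δ zero    k = 1#
  sqrtP h Δ (suc n) k =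
    if k ≤ᵇ n then sqrtP h Δ n k
    else h * (Δ (suc n) - sumN (λ j → sqrtP h Δ n (suc j) * sqrtP h Δ n (suc n ∸ suc j)) n)

  sqrtS : Carrier → Ser → Ser
  sqrtS h Δ n = sqrtP h Δ n n

  P : (ℕ → Carrier) → Ser
  P x zero    = 0#
  P x (suc n) = x (suc n)

  -- weight of a Dyck path of semilength n:  Π_{i=1}^{n} t_i^{sp_i} r_i^{ap_i}
  -- (every peak of such a path has weight ≤ n)
  pathWeight : (t r : ℕ → Carrier) → ℕ → List Step → Carrier
  pathWeight t r n w = prodFrom1 (λ i → pow (t i) (sp i w) * pow (r i) (ap i w)) n

  dyckGF : (t r : ℕ → Carrier) → Ser
  dyckGF t r n = sumList (map (pathWeight t r n) (dyckPaths n))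

  -- RHS of Theorem 2.4, with h = 1/2
  rhsGF : Carrier → (t r : ℕ → Carrier) → Ser
  rhsGF h t r =
    const h ⊛ divZ numer ⊛ inv (Q ⊛ Q)
    where
      one = const 1#
      two = const (1# + 1#)
      Pt = P t
      Pr = P r
      Q  = one ⊖ Pt ⊕ Pr
      Δ  = (one ⊖ z) ⊛ ((one ⊖ Pt) ⊛ (one ⊖ Pt)
                        ⊖ z ⊛ (one ⊖ Pt ⊕ two ⊛ Pr) ⊛ (one ⊖ Pt ⊕ two ⊛ Pr))
      numer = one ⊕ z ⊖ (one ⊕ z) ⊛ Pt ⊕ two ⊛ z ⊛ Pr ⊖ sqrtS h Δ

-- A nonempty Dyck path factors uniquely as U x D y (first return), and the maximal mountains of
-- U x D y are those of x with the first ascent and the last descent lengthened, followed by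
-- those of y.  In a primitive path U x D the first mountain is strictly longer uphill and the
-- last strictly longer downhill, unless the path is a pyramid u^a d^a; so lengthening them once
-- more changes the weight only for pyramids, whose contributions sum to a single coefficient.
-- Hence the generating series F of all paths, G = z A of the primitive paths, and E of all paths
-- with their last descent lengthened satisfy
--   F = 1 + G F,   E = 1 + G E + P(r) − P(t),   G = z (G + P(r) − P(t)) E + P(t) − z P(r).
-- The first two force E = Q F with Q = 1 − P(t) + P(r), and then the third becomes the
-- quadratic z Q² F² − B F + 1 = 0 with B = 1 + z − (1 + z) P(t) + 2 z P(r), whose discriminant
-- B² − 4 z Q² is the Δ under the square root.  So B − 2 z Q² F is a square root of Δ with
-- constant term 1, which is unique because 2 is invertible, and F = (B − √Δ) / (2 z Q²).

module Submission where

open import Level using (Level)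
open import Algebra.Bundles using (CommutativeRing; RawRing)
open import Data.Bool using (Bool; true; false; if_then_else_; _∧_; not; T)
open import Data.Bool.Properties using (T-≡)
open import Data.Empty using (⊥-elim)
open import Data.List using (List; []; _∷_; _++_; length; map; filterᵇ)
import Data.List.Properties as List
open import Data.List.Relation.Unary.All as All using (All; []; _∷_)
open import Data.Maybe using (Maybe; just; nothing)
open import Data.Nat as ℕ using (ℕ; zero; suc; _∸_; _≤_; _<_; z≤n; s≤s; _≡ᵇ_; _≤ᵇ_; _⊓_)
import Data.Nat.Properties as ℕ
open import Data.Product using (_×_; _,_)
open import Data.Sum using (_⊎_; inj₁; inj₂)
open import Data.Unit using (tt)
open import Function using (id; _∘_)
open import Function.Bundles using (Equivalence)
open import Relation.Nullary using (¬_; yes; no)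
open import Relation.Binary.PropositionalEquality as ≡ using (_≡_)
open import Algebra.Solver.Ring.AlmostCommutativeRing using (fromCommutativeRing; _-Raw-AlmostCommutative⟶_)
import Tactic.RingSolver.Core.AlmostCommutativeRing as TacticRing
open import Data.Product.Properties using (≡-dec)
open import Defs

-- The ring solver of Algebra.Solver.Ring over integer coefficients.  Tactic.RingSolver for an
-- arbitrary commutative ring uses the carrier as coefficients, so it cannot see that 1# - 1#
-- vanishes.  A pair (a , b) stands for a − b; cancel normalises it, so equal integers are
-- equal pairs and the weak coefficient equality test below is complete.
module RingSolver {c ℓ : Level} (R : CommutativeRing c ℓ) where
  cancel : ℕ × ℕ → ℕ × ℕ
  cancel (suc a , suc b) = cancel (a , b)
  cancel (a , zero)      = (a , zero)
  cancel (zero , suc b)  = (zero , suc b)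

  _+ᵖ_ _*ᵖ_ : ℕ × ℕ → ℕ × ℕ → ℕ × ℕ
  (a , b) +ᵖ (c , d) = (a ℕ.+ c , b ℕ.+ d)
  (a , b) *ᵖ (c , d) = (a ℕ.* c ℕ.+ b ℕ.* d , a ℕ.* d ℕ.+ b ℕ.* c)

  -ᵖ_ : ℕ × ℕ → ℕ × ℕ
  -ᵖ (a , b) = (b , a)

  integerCoefficients : RawRing _ _
  integerCoefficients = record
    { Carrier = ℕ × ℕ
    ; _≈_     = ≡._≡_
    ; _+_     = λ x y → cancel (x +ᵖ y)
    ; _*_     = λ x y → cancel (x *ᵖ y)
    ; -_      = -ᵖ_
    ; 0#      = (0 , 0)
    ; 1#      = (1 , 0)
    }

  open CommutativeRing R
  open import Algebra.Properties.Monoid.Mult.TCOptimised +-monoid using (×-homo-+) renaming (_×_ to _×′_)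
  open import Algebra.Properties.Semiring.Mult.TCOptimised semiring using (×1-homo-*)
  open import Algebra.Properties.Ring ring using (-‿distribˡ-*; -‿distribʳ-*; -‿involutive; -‿anti-homo-+; -0#≈0#)
  open import Relation.Binary.Reasoning.Setoid setoid
  import Tactic.RingSolver.NonReflective (TacticRing.fromCommutativeRing R (λ _ → nothing)) as Plain
  open import Tactic.RingSolver.Core.Expression using (_⊕_; ⊝_)

  ⟦_⟧ᵖ : ℕ × ℕ → Carrier
  ⟦ (a , b) ⟧ᵖ = a ×′ 1# - b ×′ 1#

  -- Chosen so that the literals (0 , 0), (1 , 0), (2 , 0) denote 0#, 1#, 1# + 1# on the nose.
  ⟦_⟧ᶜ : ℕ × ℕ → Carrier
  ⟦ (a , zero) ⟧ᶜ  = a ×′ 1#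
  ⟦ (a , suc b) ⟧ᶜ = a ×′ 1# - suc b ×′ 1#

  ⟦⟧ᶜ≈⟦⟧ᵖ : ∀ x → ⟦ x ⟧ᶜ ≈ ⟦ x ⟧ᵖ
  ⟦⟧ᶜ≈⟦⟧ᵖ (a , zero)  = sym (trans (+-congˡ -0#≈0#) (+-identityʳ _))
  ⟦⟧ᶜ≈⟦⟧ᵖ (a , suc b) = refl

  ⟦⟧ᵖ-+ : ∀ x y → ⟦ x +ᵖ y ⟧ᵖ ≈ ⟦ x ⟧ᵖ + ⟦ y ⟧ᵖ
  ⟦⟧ᵖ-+ (a , b) (c , d) = begin
    (a ℕ.+ c) ×′ 1# - (b ℕ.+ d) ×′ 1#       ≈⟨ +-cong (×-homo-+ 1# a c) (-‿cong (×-homo-+ 1# b d)) ⟩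
    (a ×′ 1# + c ×′ 1#) - (b ×′ 1# + d ×′ 1#)  ≈⟨ Plain.solve 4 (λ p r q s → ((p ⊕ r) ⊕ (⊝ (q ⊕ s))) Plain.⊜ ((p ⊕ (⊝ q)) ⊕ (r ⊕ (⊝ s)))) refl _ _ _ _ ⟩
    (a ×′ 1# - b ×′ 1#) + (c ×′ 1# - d ×′ 1#)  ∎

  difference-* : ∀ p q u v → (p - q) * (u - v) ≈ (p * u + q * v) - (p * v + q * u)
  difference-* p q u v = begin
    (p - q) * (u - v)                              ≈⟨ distribʳ _ p (- q) ⟩
    p * (u - v) + - q * (u - v)                    ≈⟨ +-cong (distribˡ p u (- v)) (trans (sym (-‿distribˡ-* q _)) (-‿cong (distribˡ q u (- v)))) ⟩
    (p * u + p * - v) + - (q * u + q * - v)        ≈⟨ +-cong (+-congˡ (sym (-‿distribʳ-* p v))) (-‿cong (+-congˡ (sym (-‿distribʳ-* q v)))) ⟩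
    (p * u + - (p * v)) + - (q * u + - (q * v))    ≈⟨ +-congˡ (trans (-‿anti-homo-+ _ _) (+-congʳ (-‿involutive _))) ⟩
    (p * u + - (p * v)) + (q * v + - (q * u))      ≈⟨ Plain.solve 4 (λ pu pv qv qu → ((pu ⊕ (⊝ pv)) ⊕ (qv ⊕ (⊝ qu))) Plain.⊜ ((pu ⊕ qv) ⊕ (⊝ (pv ⊕ qu)))) refl _ _ _ _ ⟩
    (p * u + q * v) - (p * v + q * u)              ∎

  ⟦⟧ᵖ-* : ∀ x y → ⟦ x *ᵖ y ⟧ᵖ ≈ ⟦ x ⟧ᵖ * ⟦ y ⟧ᵖ
  ⟦⟧ᵖ-* (a , b) (c , d) = begin
    (a ℕ.* c ℕ.+ b ℕ.* d) ×′ 1# - (a ℕ.* d ℕ.+ b ℕ.* c) ×′ 1#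
      ≈⟨ +-cong (trans (×-homo-+ 1# (a ℕ.* c) (b ℕ.* d)) (+-cong (×1-homo-* a c) (×1-homo-* b d)))
                (-‿cong (trans (×-homo-+ 1# (a ℕ.* d) (b ℕ.* c)) (+-cong (×1-homo-* a d) (×1-homo-* b c)))) ⟩
    (a ×′ 1# * c ×′ 1# + b ×′ 1# * d ×′ 1#) - (a ×′ 1# * d ×′ 1# + b ×′ 1# * c ×′ 1#)
      ≈⟨ sym (difference-* _ _ _ _) ⟩
    (a ×′ 1# - b ×′ 1#) * (c ×′ 1# - d ×′ 1#) ∎

  ⟦⟧ᵖ-neg : ∀ x → ⟦ -ᵖ x ⟧ᵖ ≈ - ⟦ x ⟧ᵖ
  ⟦⟧ᵖ-neg (a , b) = begin
    b ×′ 1# - a ×′ 1#          ≈⟨ +-comm _ _ ⟩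
    - (a ×′ 1#) + b ×′ 1#      ≈⟨ +-congˡ (sym (-‿involutive _)) ⟩
    - (a ×′ 1#) + - - (b ×′ 1#) ≈⟨ sym (-‿anti-homo-+ _ _) ⟩
    - (- (b ×′ 1#) + a ×′ 1#)  ≈⟨ -‿cong (+-comm _ _) ⟩
    - (a ×′ 1# - b ×′ 1#)      ∎

  ⟦⟧ᵖ-cancel : ∀ x → ⟦ cancel x ⟧ᵖ ≈ ⟦ x ⟧ᵖ
  ⟦⟧ᵖ-cancel (zero , zero)   = refl
  ⟦⟧ᵖ-cancel (suc a , zero)  = refl
  ⟦⟧ᵖ-cancel (zero , suc b)  = refl
  ⟦⟧ᵖ-cancel (suc a , suc b) = trans (⟦⟧ᵖ-cancel (a , b)) (sym (begin
    suc a ×′ 1# - suc b ×′ 1#                   ≈⟨ +-cong (×-homo-+ 1# 1 a) (-‿cong (×-homo-+ 1# 1 b)) ⟩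
    (1# + a ×′ 1#) - (1# + b ×′ 1#)             ≈⟨ +-congˡ (-‿anti-homo-+ 1# _) ⟩
    (1# + a ×′ 1#) + (- (b ×′ 1#) + - 1#)       ≈⟨ Plain.solve 4 (λ o A B O → ((o ⊕ A) ⊕ (B ⊕ O)) Plain.⊜ ((o ⊕ O) ⊕ (A ⊕ B))) refl _ _ _ _ ⟩
    (1# - 1#) + (a ×′ 1# - b ×′ 1#)             ≈⟨ trans (+-congʳ (-‿inverseʳ 1#)) (+-identityˡ _) ⟩
    a ×′ 1# - b ×′ 1#                           ∎))

  ⟦⟧ᶜ-cancel : ∀ x → ⟦ cancel x ⟧ᶜ ≈ ⟦ x ⟧ᵖ
  ⟦⟧ᶜ-cancel x = trans (⟦⟧ᶜ≈⟦⟧ᵖ (cancel x)) (⟦⟧ᵖ-cancel x)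

  _≟ᶜ_ : ∀ x y → Maybe (⟦ x ⟧ᶜ ≈ ⟦ y ⟧ᶜ)
  x ≟ᶜ y with ≡-dec ℕ._≟_ ℕ._≟_ x y
  ... | yes ≡.refl = just refl
  ... | no _       = nothing

  morphism : integerCoefficients -Raw-AlmostCommutative⟶ fromCommutativeRing R
  morphism = record
    { ⟦_⟧    = ⟦_⟧ᶜ
    ; +-homo = λ x y → trans (⟦⟧ᶜ-cancel (x +ᵖ y)) (trans (⟦⟧ᵖ-+ x y) (sym (+-cong (⟦⟧ᶜ≈⟦⟧ᵖ x) (⟦⟧ᶜ≈⟦⟧ᵖ y))))
    ; *-homo = λ x y → trans (⟦⟧ᶜ-cancel (x *ᵖ y)) (trans (⟦⟧ᵖ-* x y) (sym (*-cong (⟦⟧ᶜ≈⟦⟧ᵖ x) (⟦⟧ᶜ≈⟦⟧ᵖ y))))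
    ; -‿homo = λ x → trans (⟦⟧ᶜ≈⟦⟧ᵖ (-ᵖ x)) (trans (⟦⟧ᵖ-neg x) (-‿cong (sym (⟦⟧ᶜ≈⟦⟧ᵖ x))))
    ; 0-homo = refl
    ; 1-homo = refl
    }

  open import Algebra.Solver.Ring integerCoefficients (fromCommutativeRing R) morphism _≟ᶜ_ public
    using (solve; _:=_; con; _:+_; _:*_; :-_)

≤ᵇ-true : ∀ {m n} → m ≤ n → (m ≤ᵇ n) ≡ true
≤ᵇ-true m≤n = Equivalence.to T-≡ (ℕ.≤⇒≤ᵇ m≤n)

1+n≤ᵇn : ∀ n → (suc n ≤ᵇ n) ≡ false
1+n≤ᵇn zero    = ≡.refl
1+n≤ᵇn (suc n) = 1+n≤ᵇn n

indicator : Bool → ℕ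
indicator b = if b then 1 else 0

count-∷ : ∀ {A : Set} (p : A → Bool) x xs → count p (x ∷ xs) ≡ indicator (p x) ℕ.+ count p xs
count-∷ p x xs with p x
... | true  = ≡.refl
... | false = ≡.refl

≡ᵇ-refl : ∀ a → (a ≡ᵇ a) ≡ true
≡ᵇ-refl zero    = ≡.refl
≡ᵇ-refl (suc a) = ≡ᵇ-refl a

≢⇒≡ᵇ-false : ∀ {i j} → ¬ i ≡ j → (i ≡ᵇ j) ≡ false
≢⇒≡ᵇ-false {i} {j} i≢j with i ≡ᵇ j in eq
... | false = ≡.refl
... | true  = ⊥-elim (i≢j (ℕ.≡ᵇ⇒≡ i j (≡.subst T (≡.sym eq) tt)))

module PowerSeries {c ℓ : Level} (R : CommutativeRing c ℓ) where
  open CommutativeRing R hiding (zero)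
  open Series R
  open RingSolver R using (solve; _:=_; con; _:+_; _:*_; :-_)
  open import Algebra.Properties.Ring ring using (-0#≈0#)
  open import Relation.Binary.Reasoning.Setoid setoid

  x-0#≈x : ∀ x → x - 0# ≈ x
  x-0#≈x x = trans (+-congˡ -0#≈0#) (+-identityʳ x)

  0ₛ 1ₛ : Ser
  0ₛ _ = 0#
  1ₛ = const 1#

  -ₛ_ : Ser → Ser
  (-ₛ f) n = - f n

  sumN-cong : ∀ {F G} n → (∀ k → F k ≈ G k) → sumN F n ≈ sumN G n
  sumN-cong zero    e = refl
  sumN-cong (suc n) e = +-cong (sumN-cong n e) (e n)

  sumN-cong-< : ∀ {F G} n → (∀ k → k < n → F k ≈ G k) → sumN F n ≈ sumN G n
  sumN-cong-< zero    e = refl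
  sumN-cong-< (suc n) e = +-cong (sumN-cong-< n (λ k k<n → e k (ℕ.m<n⇒m<1+n k<n))) (e n ℕ.≤-refl)

  sumN-shift : ∀ F n → sumN F (suc n) ≈ F 0 + sumN (λ k → F (suc k)) n
  sumN-shift F zero    = trans (+-identityˡ (F 0)) (sym (+-identityʳ (F 0)))
  sumN-shift F (suc n) = trans (+-congʳ (sumN-shift F n)) (+-assoc _ _ _)

  sumN-+ : ∀ F G n → sumN (λ k → F k + G k) n ≈ sumN F n + sumN G n
  sumN-+ F G zero    = sym (+-identityʳ 0#)
  sumN-+ F G (suc n) = trans (+-congʳ (sumN-+ F G n))
    (solve 4 (λ a b x y → (a :+ b) :+ (x :+ y) := (a :+ x) :+ (b :+ y)) refl _ _ _ _)

  sumN-zero : ∀ {F} n → (∀ k → F k ≈ 0#) → sumN F n ≈ 0#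
  sumN-zero zero    e = refl
  sumN-zero (suc n) e = trans (+-cong (sumN-zero n e) (e n)) (+-identityʳ 0#)

  ⊛-zero : ∀ f g → (f ⊛ g) 0 ≈ f 0 * g 0
  ⊛-zero f g = +-identityˡ _

  ⊛-suc : ∀ f g n → (f ⊛ g) (suc n) ≈ f 0 * g (suc n) + (divZ f ⊛ g) n
  ⊛-suc f g n = sumN-shift (λ k → f k * g (suc n ∸ k)) (suc n)

  ⊛-cong : ∀ {f f′ g g′} → f ≋ f′ → g ≋ g′ → (f ⊛ g) ≋ (f′ ⊛ g′)
  ⊛-cong ef eg n = sumN-cong (suc n) (λ k → *-cong (ef k) (eg (n ∸ k)))

  ⊛-distribʳ : ∀ f g h → ((f ⊕ g) ⊛ h) ≋ (f ⊛ h ⊕ g ⊛ h)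
  ⊛-distribʳ f g h n = trans (sumN-cong (suc n) (λ k → distribʳ (h (n ∸ k)) (f k) (g k))) (sumN-+ _ _ (suc n))

  ⊛-distribˡ : ∀ h f g → (h ⊛ (f ⊕ g)) ≋ (h ⊛ f ⊕ h ⊛ g)
  ⊛-distribˡ h f g n = trans (sumN-cong (suc n) (λ k → distribˡ (h k) (f (n ∸ k)) (g (n ∸ k)))) (sumN-+ _ _ (suc n))

  ⊛-zeroˡ : ∀ f g → (∀ k → f k ≈ 0#) → ∀ n → (f ⊛ g) n ≈ 0#
  ⊛-zeroˡ f g f≈0 n = sumN-zero (suc n) (λ k → trans (*-congʳ (f≈0 k)) (zeroˡ _))

  const-⊛ : ∀ a g n → (const a ⊛ g) n ≈ a * g n
  const-⊛ a g zero    = ⊛-zero (const a) g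
  const-⊛ a g (suc n) = begin
    (const a ⊛ g) (suc n)              ≈⟨ ⊛-suc (const a) g n ⟩
    a * g (suc n) + (divZ (const a) ⊛ g) n ≈⟨ +-congˡ (⊛-zeroˡ (divZ (const a)) g (λ _ → refl) n) ⟩
    a * g (suc n) + 0#                 ≈⟨ +-identityʳ _ ⟩
    a * g (suc n)                      ∎

  ⊛-comm : ∀ f g → (f ⊛ g) ≋ (g ⊛ f)
  ⊛-comm f g zero = trans (⊛-zero f g) (trans (*-comm _ _) (sym (⊛-zero g f)))
  ⊛-comm f g (suc zero) = begin
    (f ⊛ g) 1                     ≈⟨ trans (⊛-suc f g 0) (+-congˡ (⊛-zero (divZ f) g)) ⟩
    f 0 * g 1 + f 1 * g 0         ≈⟨ solve 4 (λ a b c d → a :* b :+ c :* d := d :* c :+ b :* a) refl _ _ _ _ ⟩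
    g 0 * f 1 + g 1 * f 0         ≈⟨ sym (trans (⊛-suc g f 0) (+-congˡ (⊛-zero (divZ g) f))) ⟩
    (g ⊛ f) 1                     ∎
  ⊛-comm f g (suc (suc m)) = begin
    (f ⊛ g) (2 ℕ.+ m)                                        ≈⟨ ⊛-suc f g (suc m) ⟩
    f 0 * g (2 ℕ.+ m) + (divZ f ⊛ g) (suc m)                 ≈⟨ +-congˡ (trans (⊛-comm (divZ f) g (suc m)) (⊛-suc g (divZ f) m)) ⟩
    f 0 * g (2 ℕ.+ m) + (g 0 * f (2 ℕ.+ m) + (divZ g ⊛ divZ f) m)
      ≈⟨ +-congˡ (+-congˡ (⊛-comm (divZ g) (divZ f) m)) ⟩
    f 0 * g (2 ℕ.+ m) + (g 0 * f (2 ℕ.+ m) + (divZ f ⊛ divZ g) m)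
      ≈⟨ solve 3 (λ a b x → a :+ (b :+ x) := b :+ (a :+ x)) refl _ _ _ ⟩
    g 0 * f (2 ℕ.+ m) + (f 0 * g (2 ℕ.+ m) + (divZ f ⊛ divZ g) m)
      ≈⟨ +-congˡ (trans (sym (⊛-suc f (divZ g) m)) (⊛-comm f (divZ g) (suc m))) ⟩
    g 0 * f (2 ℕ.+ m) + (divZ g ⊛ f) (suc m)                 ≈⟨ sym (⊛-suc g f (suc m)) ⟩
    (g ⊛ f) (2 ℕ.+ m)                                        ∎

  ⊛-1ₛ : ∀ f n → (f ⊛ 1ₛ) n ≈ f n
  ⊛-1ₛ f n = trans (⊛-comm f 1ₛ n) (trans (const-⊛ 1# f n) (*-identityˡ _))

  divZ-⊛ : ∀ f g → divZ (f ⊛ g) ≋ (const (f 0) ⊛ divZ g ⊕ divZ f ⊛ g)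
  divZ-⊛ f g k = trans (⊛-suc f g k) (+-congʳ (sym (const-⊛ (f 0) (divZ g) k)))

  ⊛-assoc : ∀ f g h → ((f ⊛ g) ⊛ h) ≋ (f ⊛ (g ⊛ h))
  ⊛-assoc f g h zero = begin
    ((f ⊛ g) ⊛ h) 0      ≈⟨ trans (⊛-zero (f ⊛ g) h) (*-congʳ (⊛-zero f g)) ⟩
    (f 0 * g 0) * h 0    ≈⟨ *-assoc _ _ _ ⟩
    f 0 * (g 0 * h 0)    ≈⟨ sym (trans (⊛-zero f (g ⊛ h)) (*-congˡ (⊛-zero g h))) ⟩
    (f ⊛ (g ⊛ h)) 0      ∎
  ⊛-assoc f g h (suc n) = begin
    ((f ⊛ g) ⊛ h) (suc n)
      ≈⟨ ⊛-suc (f ⊛ g) h n ⟩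
    (f ⊛ g) 0 * h (suc n) + (divZ (f ⊛ g) ⊛ h) n
      ≈⟨ +-cong (*-congʳ (⊛-zero f g))
                (trans (⊛-cong {divZ (f ⊛ g)} {const (f 0) ⊛ divZ g ⊕ divZ f ⊛ g} {h} {h} (divZ-⊛ f g) (λ _ → refl) n)
                       (⊛-distribʳ _ _ h n)) ⟩
    (f 0 * g 0) * h (suc n) + (((const (f 0) ⊛ divZ g) ⊛ h) n + ((divZ f ⊛ g) ⊛ h) n)
      ≈⟨ +-congˡ (+-cong (trans (⊛-assoc (const (f 0)) (divZ g) h n) (const-⊛ (f 0) (divZ g ⊛ h) n)) (⊛-assoc (divZ f) g h n)) ⟩
    (f 0 * g 0) * h (suc n) + (f 0 * (divZ g ⊛ h) n + (divZ f ⊛ (g ⊛ h)) n)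
      ≈⟨ solve 5 (λ a b c x y → (a :* b) :* c :+ (a :* x :+ y) := a :* (b :* c :+ x) :+ y) refl _ _ _ _ _ ⟩
    f 0 * (g 0 * h (suc n) + (divZ g ⊛ h) n) + (divZ f ⊛ (g ⊛ h)) n
      ≈⟨ +-congʳ (*-congˡ (sym (⊛-suc g h n))) ⟩
    f 0 * (g ⊛ h) (suc n) + (divZ f ⊛ (g ⊛ h)) n
      ≈⟨ sym (⊛-suc f (g ⊛ h) n) ⟩
    (f ⊛ (g ⊛ h)) (suc n) ∎

  -- _≋_ is a Π-type, from which Agda cannot infer the two series; the record wrapper restores inference.
  infix 4 _≈ₛ_
  record _≈ₛ_ (f g : Ser) : Set ℓ where
    constructor mk
    field un : f ≋ g
  open _≈ₛ_ public

  seriesRing : CommutativeRing c ℓ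
  seriesRing = record
    { Carrier = Ser
    ; _≈_ = _≈ₛ_
    ; _+_ = _⊕_
    ; _*_ = _⊛_
    ; -_  = -ₛ_
    ; 0#  = 0ₛ
    ; 1#  = 1ₛ
    ; isCommutativeRing = record
      { isRing = record
        { +-isAbelianGroup = record
          { isGroup = record
            { isMonoid = record
              { isSemigroup = record
                { isMagma = record
                  { isEquivalence = record
                    { refl  = mk (λ n → refl)
                    ; sym   = λ e → mk (λ n → sym (un e n))
                    ; trans = λ e e′ → mk (λ n → trans (un e n) (un e′ n))
                    }
                  ; ∙-cong = λ e e′ → mk (λ n → +-cong (un e n) (un e′ n))
                  }
                ; assoc = λ f g h → mk (λ n → +-assoc (f n) (g n) (h n))
                }
              ; identity = (λ f → mk (λ n → +-identityˡ (f n))) , (λ f → mk (λ n → +-identityʳ (f n)))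
              }
            ; inverse = (λ f → mk (λ n → -‿inverseˡ (f n))) , (λ f → mk (λ n → -‿inverseʳ (f n)))
            ; ⁻¹-cong = λ e → mk (λ n → -‿cong (un e n))
            }
          ; comm = λ f g → mk (λ n → +-comm (f n) (g n))
          }
        ; *-cong     = λ e e′ → mk (⊛-cong (un e) (un e′))
        ; *-assoc    = λ f g h → mk (⊛-assoc f g h)
        ; *-identity = (λ f → mk (1ₛ-⊛ f)) , (λ f → mk (λ n → trans (⊛-comm f 1ₛ n) (1ₛ-⊛ f n)))
        ; distrib    = (λ h f g → mk (⊛-distribˡ h f g)) , (λ h f g → mk (⊛-distribʳ f g h))
        }
      ; *-comm = λ f g → mk (⊛-comm f g)
      }
    }
    where
      1ₛ-⊛ : ∀ f → (1ₛ ⊛ f) ≋ f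
      1ₛ-⊛ f n = trans (const-⊛ 1# f n) (*-identityˡ (f n))

  -- Congruences with the fixed operand explicit, since it cannot be inferred through _⊕_ and _⊛_.
  ⊕-congˡ : ∀ f {g g′} → g ≈ₛ g′ → f ⊕ g ≈ₛ f ⊕ g′
  ⊕-congˡ f g≈g′ = mk (λ n → +-congˡ (un g≈g′ n))

  ⊕-congʳ : ∀ f {g g′} → g ≈ₛ g′ → g ⊕ f ≈ₛ g′ ⊕ f
  ⊕-congʳ f g≈g′ = mk (λ n → +-congʳ (un g≈g′ n))

  ⊛-congˡ : ∀ f {g g′} → g ≈ₛ g′ → f ⊛ g ≈ₛ f ⊛ g′
  ⊛-congˡ f g≈g′ = mk (⊛-cong {f} {f} (λ _ → refl) (un g≈g′))

  ⊛-congʳ : ∀ f {g g′} → g ≈ₛ g′ → g ⊛ f ≈ₛ g′ ⊛ f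
  ⊛-congʳ f g≈g′ = mk (⊛-cong {g = f} {g′ = f} (un g≈g′) (λ _ → refl))

  ⊖-congʳ : ∀ f {g g′} → g ≈ₛ g′ → g ⊖ f ≈ₛ g′ ⊖ f
  ⊖-congʳ f g≈g′ = mk (λ n → +-congʳ (un g≈g′ n))

  z-⊛-zero : ∀ f → (z ⊛ f) 0 ≈ 0#
  z-⊛-zero f = trans (⊛-zero z f) (zeroˡ (f 0))

  z-⊛-suc : ∀ f n → (z ⊛ f) (suc n) ≈ f n
  z-⊛-suc f n = begin
    (z ⊛ f) (suc n)              ≈⟨ ⊛-suc z f n ⟩
    0# * f (suc n) + (divZ z ⊛ f) n ≈⟨ +-cong (zeroˡ _) (⊛-cong {divZ z} {1ₛ} {f} {f} divZ-z≋1ₛ (λ _ → refl) n) ⟩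
    0# + (1ₛ ⊛ f) n              ≈⟨ trans (+-identityˡ _) (const-⊛ 1# f n) ⟩
    1# * f n                     ≈⟨ *-identityˡ _ ⟩
    f n                          ∎
    where
      divZ-z≋1ₛ : divZ z ≋ 1ₛ
      divZ-z≋1ₛ zero    = refl
      divZ-z≋1ₛ (suc n) = refl

  divZ-z-⊛ : ∀ f → divZ (z ⊛ f) ≋ f
  divZ-z-⊛ = z-⊛-suc

  z-⊛-divZ : ∀ f → f 0 ≈ 0# → (z ⊛ divZ f) ≋ f
  z-⊛-divZ f f0≈0 zero    = trans (z-⊛-zero (divZ f)) (sym f0≈0)
  z-⊛-divZ f _    (suc n) = z-⊛-suc (divZ f) n

  ≋-const⊕z⊛ : ∀ f g a → f 0 ≈ a → divZ f ≋ g → f ≋ (const a ⊕ z ⊛ g)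
  ≋-const⊕z⊛ f g a f0≈a _ zero    = trans f0≈a (trans (sym (+-identityʳ a)) (+-congˡ (sym (z-⊛-zero g))))
  ≋-const⊕z⊛ f g a _ f′≋g (suc n) = trans (f′≋g n) (trans (sym (z-⊛-suc g n)) (sym (+-identityˡ _)))

  -- Since g 0 ≈ 0#, each coefficient of f is a combination of lower ones.
  fixpoint≋0 : ∀ f g → f ≋ (g ⊛ f) → g 0 ≈ 0# → f ≋ 0ₛ
  fixpoint≋0 f g f≋gf g0≈0 n = vanishes-≤ n n ℕ.≤-refl
    where
      vanishes-≤ : ∀ n k → k ≤ n → f k ≈ 0#
      vanishes-≤ zero .zero z≤n = trans (f≋gf 0) (trans (⊛-zero g f) (trans (*-congʳ g0≈0) (zeroˡ _)))
      vanishes-≤ (suc n) k k≤1+n with ℕ.m≤n⇒m<n∨m≡n k≤1+n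
      ... | inj₁ k<1+n  = vanishes-≤ n k (ℕ.<⇒≤pred k<1+n)
      ... | inj₂ ≡.refl = begin
        f (suc n)                            ≈⟨ trans (f≋gf (suc n)) (⊛-suc g f n) ⟩
        g 0 * f (suc n) + (divZ g ⊛ f) n     ≈⟨ +-cong (trans (*-congʳ g0≈0) (zeroˡ _))
                                                       (sumN-zero (suc n) (λ j → trans (*-congˡ (vanishes-≤ n (n ∸ j) (ℕ.m∸n≤m n j))) (zeroʳ _))) ⟩
        0# + 0#                              ≈⟨ +-identityʳ 0# ⟩
        0#                                   ∎

  invP-stable : ∀ A n k → k ≤ n → invP A n k ≡ inv A k
  invP-stable A zero    .zero z≤n = ≡.refl
  invP-stable A (suc n) k k≤1+n with ℕ.m≤n⇒m<n∨m≡n k≤1+n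
  ... | inj₁ k<1+n rewrite ≤ᵇ-true (ℕ.<⇒≤pred k<1+n) = invP-stable A n k (ℕ.<⇒≤pred k<1+n)
  ... | inj₂ ≡.refl = ≡.refl

  inv-suc : ∀ A n → inv A (suc n) ≈ - (divZ A ⊛ inv A) n
  inv-suc A n rewrite 1+n≤ᵇn n =
    -‿cong (sumN-cong (suc n) (λ j → *-congˡ (reflexive (invP-stable A n (n ∸ j) (ℕ.m∸n≤m n j)))))

  inv-inverseʳ : ∀ A → A 0 ≈ 1# → (A ⊛ inv A) ≋ 1ₛ
  inv-inverseʳ A A0≈1 zero    = trans (⊛-zero A (inv A)) (trans (*-identityʳ (A 0)) A0≈1)
  inv-inverseʳ A A0≈1 (suc n) = begin
    (A ⊛ inv A) (suc n)                                  ≈⟨ ⊛-suc A (inv A) n ⟩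
    A 0 * inv A (suc n) + (divZ A ⊛ inv A) n             ≈⟨ +-congʳ (trans (*-cong A0≈1 (inv-suc A n)) (*-identityˡ _)) ⟩
    - (divZ A ⊛ inv A) n + (divZ A ⊛ inv A) n            ≈⟨ -‿inverseˡ _ ⟩
    0#                                                   ∎

  module SquareRoot (h : Carrier) (2h≈1 : (1# + 1#) * h ≈ 1#) (Δ : Ser) where

    sqrtP-stable : ∀ n k → k ≤ n → sqrtP h Δ n k ≡ sqrtS h Δ k
    sqrtP-stable zero    .zero z≤n = ≡.refl
    sqrtP-stable (suc n) k k≤1+n with ℕ.m≤n⇒m<n∨m≡n k≤1+n
    ... | inj₁ k<1+n rewrite ≤ᵇ-true (ℕ.<⇒≤pred k<1+n) = sqrtP-stable n k (ℕ.<⇒≤pred k<1+n)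
    ... | inj₂ ≡.refl = ≡.refl

    middle : Ser → ℕ → Carrier
    middle S n = sumN (λ j → S (suc j) * S (n ∸ j)) n

    sqrtS-suc : ∀ n → sqrtS h Δ (suc n) ≈ h * (Δ (suc n) - middle (sqrtS h Δ) n)
    sqrtS-suc n rewrite 1+n≤ᵇn n =
      *-congˡ (+-congˡ (-‿cong (sumN-cong-< n (λ j j<n →
        *-cong (reflexive (sqrtP-stable n (suc j) j<n)) (reflexive (sqrtP-stable n (n ∸ j) (ℕ.m∸n≤m n j)))))))

    square-suc : ∀ S n → (S ⊛ S) (suc n) ≈ S 0 * S (suc n) + (middle S n + S (suc n) * S 0)
    square-suc S n = trans (⊛-suc S S n) (+-congˡ (+-congˡ (*-congˡ (reflexive (≡.cong S (ℕ.n∸n≡0 n))))))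

    -- Since 2 is invertible, S (n+1) is determined by Δ (n+1) and the lower coefficients of S.
    sqrtS-unique : ∀ S → S 0 ≈ 1# → (S ⊛ S) ≋ Δ → S ≋ sqrtS h Δ
    sqrtS-unique S S0≈1 S²≋Δ n = agrees-≤ n n ℕ.≤-refl
      where
        agrees-≤ : ∀ n k → k ≤ n → S k ≈ sqrtS h Δ k
        agrees-≤ zero .zero z≤n = S0≈1
        agrees-≤ (suc n) k k≤1+n with ℕ.m≤n⇒m<n∨m≡n k≤1+n
        ... | inj₁ k<1+n  = agrees-≤ n k (ℕ.<⇒≤pred k<1+n)
        ... | inj₂ ≡.refl = sym (begin
          sqrtS h Δ (suc n)                             ≈⟨ sqrtS-suc n ⟩
          h * (Δ (suc n) - middle (sqrtS h Δ) n)        ≈⟨ *-congˡ (+-cong (sym (S²≋Δ (suc n))) (-‿cong (sym middle≈))) ⟩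
          h * ((S ⊛ S) (suc n) - middle S n)            ≈⟨ *-congˡ (+-congʳ (square-suc S n)) ⟩
          h * ((S 0 * S (suc n) + (middle S n + S (suc n) * S 0)) - middle S n)
            ≈⟨ solve 4 (λ H s₀ s m → H :* ((s₀ :* s :+ (m :+ s :* s₀)) :+ (:- m)) := (s₀ :+ s₀) :* H :* s) refl h (S 0) (S (suc n)) (middle S n) ⟩
          (S 0 + S 0) * h * S (suc n)                   ≈⟨ *-congʳ (trans (*-congʳ (+-cong S0≈1 S0≈1)) 2h≈1) ⟩
          1# * S (suc n)                                ≈⟨ *-identityˡ _ ⟩
          S (suc n)                                     ∎)
          where
            middle≈ : middle S n ≈ middle (sqrtS h Δ) n
            middle≈ = sumN-cong-< n (λ j j<n → *-cong (agrees-≤ n (suc j) j<n) (agrees-≤ n (n ∸ j) (ℕ.m∸n≤m n j)))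

  pow-+ : ∀ x a b → pow x (a ℕ.+ b) ≈ pow x a * pow x b
  pow-+ x zero    b = sym (*-identityˡ _)
  pow-+ x (suc a) b = trans (*-congʳ (pow-+ x a b)) (solve 3 (λ p q y → (p :* q) :* y := (p :* y) :* q) refl _ _ _)

  prodFrom1-cong : ∀ {f g} n → (∀ i → f i ≈ g i) → prodFrom1 f n ≈ prodFrom1 g n
  prodFrom1-cong zero    f≈g = refl
  prodFrom1-cong (suc n) f≈g = *-cong (prodFrom1-cong n f≈g) (f≈g (suc n))

  prodFrom1-* : ∀ f g n → prodFrom1 (λ i → f i * g i) n ≈ prodFrom1 f n * prodFrom1 g n
  prodFrom1-* f g zero    = sym (*-identityˡ 1#)
  prodFrom1-* f g (suc n) = trans (*-congʳ (prodFrom1-* f g n)) (solve 4 (λ a b c d → (a :* b) :* (c :* d) := (a :* c) :* (b :* d)) refl _ _ _ _)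

  prodFrom1-one : ∀ f n → (∀ i → i ≤ n → f i ≈ 1#) → prodFrom1 f n ≈ 1#
  prodFrom1-one f zero    f≈1 = refl
  prodFrom1-one f (suc n) f≈1 = trans (*-cong (prodFrom1-one f n (λ i i≤n → f≈1 i (ℕ.m≤n⇒m≤1+n i≤n))) (f≈1 (suc n) ℕ.≤-refl)) (*-identityˡ 1#)

  prodFrom1-single : ∀ f n k → 1 ≤ k → k ≤ n → (∀ i → ¬ i ≡ k → f i ≈ 1#) → prodFrom1 f n ≈ f k
  prodFrom1-single f zero    k (s≤s _) ()
  prodFrom1-single f (suc n) k 1≤k k≤1+n f≈1 with ℕ.m≤n⇒m<n∨m≡n k≤1+n
  ... | inj₁ k<1+n  = trans (*-cong (prodFrom1-single f n k 1≤k (ℕ.<⇒≤pred k<1+n) f≈1) (f≈1 (suc n) (ℕ.>⇒≢ k<1+n))) (*-identityʳ _)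
  ... | inj₂ ≡.refl = trans (*-congʳ (prodFrom1-one f n (λ i i≤n → f≈1 i (ℕ.<⇒≢ (s≤s i≤n))))) (*-identityˡ _)

  prodFrom1-at : ∀ n (x : ℕ → Carrier) k → 1 ≤ k → k ≤ n → prodFrom1 (λ i → pow (x i) (indicator (k ≡ᵇ i))) n ≈ x k
  prodFrom1-at n x k 1≤k k≤n =
    trans (prodFrom1-single _ n k 1≤k k≤n (λ i i≢k → reflexive (≡.cong (λ b → pow (x i) (indicator b)) (≢⇒≡ᵇ-false (i≢k ∘ ≡.sym)))))
          (trans (reflexive (≡.cong (λ b → pow (x k) (indicator b)) (≡ᵇ-refl k))) (*-identityˡ (x k)))

module Mountains where
  open import Data.Nat using (_+_)
  open import Relation.Binary.PropositionalEquality using (refl; cong; sym; trans; subst; module ≡-Reasoning)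

  Mountain : Set
  Mountain = ℕ × ℕ

  Run : Set
  Run = Step × ℕ

  data NonEmpty {A : Set} : List A → Set where
    nonempty : ∀ {x xs} → NonEmpty (x ∷ xs)

  incUp incDown : Mountain → Mountain
  incUp   (i , j) = (suc i , j)
  incDown (i , j) = (i , suc j)

  incFirst : List Mountain → List Mountain
  incFirst []      = []
  incFirst (p ∷ M) = incUp p ∷ M

  incLast : List Mountain → List Mountain
  incLast []          = []
  incLast (p ∷ [])    = incDown p ∷ []
  incLast (p ∷ q ∷ M) = p ∷ incLast (q ∷ M)

  -- The mountains of U x D in terms of those of x.
  lift : List Mountain → List Mountain
  lift []      = (1 , 1) ∷ []
  lift (p ∷ M) = incLast (incUp p ∷ M)

  lift-nonempty : ∀ M → NonEmpty (lift M)
  lift-nonempty []          = nonempty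
  lift-nonempty (p ∷ [])    = nonempty
  lift-nonempty (p ∷ q ∷ M) = nonempty

  incLast-nonempty : ∀ q M → NonEmpty (incLast (q ∷ M))
  incLast-nonempty q []      = nonempty
  incLast-nonempty q (_ ∷ _) = nonempty

  ++-nonemptyʳ : ∀ {A : Set} (xs : List A) {ys} → NonEmpty ys → NonEmpty (xs ++ ys)
  ++-nonemptyʳ []      ne = ne
  ++-nonemptyʳ (_ ∷ _) _  = nonempty

  incLast-++ : ∀ A q M → incLast (A ++ q ∷ M) ≡ A ++ incLast (q ∷ M)
  incLast-++ []          q M = refl
  incLast-++ (a ∷ [])    q M = refl
  incLast-++ (a ∷ b ∷ A) q M = cong (a ∷_) (incLast-++ (b ∷ A) q M)

  lift-++ : ∀ p A q M → lift ((p ∷ A) ++ q ∷ M) ≡ incFirst (p ∷ A) ++ incLast (q ∷ M)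
  lift-++ p A q M = incLast-++ (incUp p ∷ A) q M

  pushRunBy : Run → List Run → List Run
  pushRunBy (U , k) ((U , m) ∷ rs) = (U , k + m) ∷ rs
  pushRunBy (D , k) ((D , m) ∷ rs) = (D , k + m) ∷ rs
  pushRunBy r       rs             = r ∷ rs

  joinRuns : List Run → List Run → List Run
  joinRuns []          rs = rs
  joinRuns (p ∷ [])    rs = pushRunBy p rs
  joinRuns (p ∷ q ∷ L) rs = p ∷ joinRuns (q ∷ L) rs

  pushRun-joinRuns : ∀ s L rs → pushRun s (joinRuns L rs) ≡ joinRuns (pushRun s L) rs
  pushRun-joinRuns U []              []              = refl
  pushRun-joinRuns D []              []              = refl
  pushRun-joinRuns U []              ((U , m) ∷ rs)  = refl
  pushRun-joinRuns U []              ((D , m) ∷ rs)  = refl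
  pushRun-joinRuns D []              ((U , m) ∷ rs)  = refl
  pushRun-joinRuns D []              ((D , m) ∷ rs)  = refl
  pushRun-joinRuns U ((U , k) ∷ [])  []              = refl
  pushRun-joinRuns U ((D , k) ∷ [])  []              = refl
  pushRun-joinRuns D ((U , k) ∷ [])  []              = refl
  pushRun-joinRuns D ((D , k) ∷ [])  []              = refl
  pushRun-joinRuns U ((U , k) ∷ [])  ((U , m) ∷ rs)  = refl
  pushRun-joinRuns U ((U , k) ∷ [])  ((D , m) ∷ rs)  = refl
  pushRun-joinRuns U ((D , k) ∷ [])  ((U , m) ∷ rs)  = refl
  pushRun-joinRuns U ((D , k) ∷ [])  ((D , m) ∷ rs)  = refl
  pushRun-joinRuns D ((U , k) ∷ [])  ((U , m) ∷ rs)  = refl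
  pushRun-joinRuns D ((U , k) ∷ [])  ((D , m) ∷ rs)  = refl
  pushRun-joinRuns D ((D , k) ∷ [])  ((U , m) ∷ rs)  = refl
  pushRun-joinRuns D ((D , k) ∷ [])  ((D , m) ∷ rs)  = refl
  pushRun-joinRuns U ((U , k) ∷ q ∷ L) rs = refl
  pushRun-joinRuns U ((D , k) ∷ q ∷ L) rs = refl
  pushRun-joinRuns D ((U , k) ∷ q ∷ L) rs = refl
  pushRun-joinRuns D ((D , k) ∷ q ∷ L) rs = refl

  runs-++ : ∀ x y → runs (x ++ y) ≡ joinRuns (runs x) (runs y)
  runs-++ []      y = refl
  runs-++ (s ∷ x) y = trans (cong (pushRun s) (runs-++ x y)) (pushRun-joinRuns s (runs x) (runs y))

  mutual
    data UpFirst : List Run → Set where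
      up : ∀ i {L} → DownFirst L → UpFirst ((U , i) ∷ L)

    data DownFirst : List Run → Set where
      down-end : ∀ j → DownFirst ((D , j) ∷ [])
      down     : ∀ j {L} → UpFirst L → DownFirst ((D , j) ∷ L)

  pushRun-U : ∀ {L} → UpFirst L ⊎ DownFirst L → UpFirst (pushRun U L)
  pushRun-U (inj₁ (up i d))     = up (suc i) d
  pushRun-U (inj₂ (down-end j)) = up 1 (down-end j)
  pushRun-U (inj₂ (down j u))   = up 1 (down j u)

  pushRun-D : ∀ {L} → UpFirst L ⊎ DownFirst L → DownFirst (pushRun D L)
  pushRun-D (inj₁ (up i d))     = down 1 (up i d)
  pushRun-D (inj₂ (down-end j)) = down-end (suc j)
  pushRun-D (inj₂ (down j u))   = down (suc j) u

  mutual
    runs-alternate : ∀ h s x → dyckFrom h (s ∷ x) ≡ true → UpFirst (runs (s ∷ x)) ⊎ DownFirst (runs (s ∷ x))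
    runs-alternate zero    U x       ok = inj₁ (runs-alternate-U 0 x ok)
    runs-alternate (suc h) U x       ok = inj₁ (runs-alternate-U (suc h) x ok)
    runs-alternate (suc h) D []      ok = inj₂ (down-end 1)
    runs-alternate (suc h) D (s ∷ x) ok = inj₂ (pushRun-D (runs-alternate h s x ok))

    runs-alternate-U : ∀ h x → dyckFrom (suc h) x ≡ true → UpFirst (runs (U ∷ x))
    runs-alternate-U h (s ∷ x) ok = pushRun-U (runs-alternate (suc h) s x ok)

  dyck-runs : ∀ x → isDyck x ≡ true → x ≡ [] ⊎ UpFirst (runs x)
  dyck-runs []      _  = inj₁ refl
  dyck-runs (U ∷ x) ok = inj₂ (runs-alternate-U 0 x ok)

  incLastRun : List Run → List Run
  incLastRun []             = []
  incLastRun ((s , k) ∷ [])  = (s , suc k) ∷ []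
  incLastRun (p ∷ q ∷ L)    = p ∷ incLastRun (q ∷ L)

  mutual
    joinRuns-D-U : ∀ {L} Y → UpFirst L → joinRuns L ((D , 1) ∷ Y) ≡ incLastRun L ++ Y
    joinRuns-D-U Y (up i d@(down-end j)) = cong ((U , i) ∷_) (joinRuns-D-D Y d)
    joinRuns-D-U Y (up i d@(down j u))   = cong ((U , i) ∷_) (joinRuns-D-D Y d)

    joinRuns-D-D : ∀ {L} Y → DownFirst L → joinRuns L ((D , 1) ∷ Y) ≡ incLastRun L ++ Y
    joinRuns-D-D Y (down-end j)        = cong (λ k → (D , k) ∷ Y) (ℕ.+-comm j 1)
    joinRuns-D-D Y (down j u@(up i d)) = cong ((D , j) ∷_) (joinRuns-D-U Y u)

  incLastRun-U : ∀ {L} → UpFirst L → UpFirst (incLastRun L)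
  incLastRun-U (up i (down-end j))       = up i (down-end (suc j))
  incLastRun-U (up i (down j u@(up _ _))) = up i (down j (incLastRun-U u))

  mountainsOfRuns-++ : ∀ {L} Y → UpFirst L → mountainsOfRuns (L ++ Y) ≡ mountainsOfRuns L ++ mountainsOfRuns Y
  mountainsOfRuns-++ Y (up i (down-end j)) = refl
  mountainsOfRuns-++ Y (up i (down j u@(up _ _))) = cong ((i , j) ∷_) (mountainsOfRuns-++ Y u)

  mountainsOfRuns-nonempty : ∀ {L} → UpFirst L → NonEmpty (mountainsOfRuns L)
  mountainsOfRuns-nonempty (up i (down-end j)) = nonempty
  mountainsOfRuns-nonempty (up i (down j u))   = nonempty

  incLast-∷ : ∀ p {K} → NonEmpty K → incLast (p ∷ K) ≡ p ∷ incLast K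
  incLast-∷ p nonempty = refl

  mountainsOfRuns-incLastRun : ∀ {L} → UpFirst L → mountainsOfRuns (incLastRun L) ≡ incLast (mountainsOfRuns L)
  mountainsOfRuns-incLastRun (up i (down-end j)) = refl
  mountainsOfRuns-incLastRun (up i (down j u@(up _ _))) =
    trans (cong ((i , j) ∷_) (mountainsOfRuns-incLastRun u)) (sym (incLast-∷ (i , j) (mountainsOfRuns-nonempty u)))

  mountainsOfRuns-lift : ∀ {K} Y → UpFirst K → mountainsOfRuns (pushRun U (incLastRun K ++ Y)) ≡ lift (mountainsOfRuns K) ++ mountainsOfRuns Y
  mountainsOfRuns-lift Y (up i (down-end j))          = refl
  mountainsOfRuns-lift Y (up i (down j {L} u@(up _ _))) = begin
    (suc i , j) ∷ mountainsOfRuns (incLastRun L ++ Y)             ≡⟨ cong ((suc i , j) ∷_) (mountainsOfRuns-++ Y (incLastRun-U u)) ⟩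
    (suc i , j) ∷ mountainsOfRuns (incLastRun L) ++ mountainsOfRuns Y ≡⟨ cong (λ M → (suc i , j) ∷ M ++ mountainsOfRuns Y) (mountainsOfRuns-incLastRun u) ⟩
    ((suc i , j) ∷ incLast (mountainsOfRuns L)) ++ mountainsOfRuns Y ≡⟨ cong (_++ mountainsOfRuns Y) (sym (incLast-∷ (suc i , j) (mountainsOfRuns-nonempty u))) ⟩
    lift ((i , j) ∷ mountainsOfRuns L) ++ mountainsOfRuns Y       ∎
    where open ≡-Reasoning

  pushRun-D-dyck : ∀ y → isDyck y ≡ true → pushRun D (runs y) ≡ (D , 1) ∷ runs y
  pushRun-D-dyck y ok with dyck-runs y ok
  ... | inj₁ refl = refl
  ... | inj₂ u with runs y | u
  ... | (U , i) ∷ L | up .i _ = refl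

  mountains-firstReturn : ∀ x y → isDyck x ≡ true → isDyck y ≡ true →
                          mountains (U ∷ x ++ D ∷ y) ≡ lift (mountains x) ++ mountains y
  mountains-firstReturn x y x-ok y-ok with dyck-runs x x-ok
  ... | inj₁ refl rewrite pushRun-D-dyck y y-ok = refl
  ... | inj₂ u = begin
    mountainsOfRuns (pushRun U (runs (x ++ D ∷ y)))
      ≡⟨ cong (λ K → mountainsOfRuns (pushRun U K)) (runs-++ x (D ∷ y)) ⟩
    mountainsOfRuns (pushRun U (joinRuns (runs x) (pushRun D (runs y))))
      ≡⟨ cong (λ K → mountainsOfRuns (pushRun U (joinRuns (runs x) K))) (pushRun-D-dyck y y-ok) ⟩
    mountainsOfRuns (pushRun U (joinRuns (runs x) ((D , 1) ∷ runs y)))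
      ≡⟨ cong (λ K → mountainsOfRuns (pushRun U K)) (joinRuns-D-U (runs y) u) ⟩
    mountainsOfRuns (pushRun U (incLastRun (runs x) ++ runs y))
      ≡⟨ mountainsOfRuns-lift (runs y) u ⟩
    lift (mountains x) ++ mountains y ∎
    where open ≡-Reasoning

  -- A structural ≤ test, so that it computes on suc k and suc h for variable k and h.
  atMost : ℕ → ℕ → Bool
  atMost zero    h       = true
  atMost (suc k) zero    = false
  atMost (suc k) (suc h) = atMost k h

  atMost-sound : ∀ k h → atMost k h ≡ true → k ≤ h
  atMost-sound zero    h       _  = z≤n
  atMost-sound (suc k) (suc h) ok = s≤s (atMost-sound k h ok)

  ∧-true : ∀ a b → a ∧ b ≡ true → a ≡ true × b ≡ true
  ∧-true true true _ = refl , refl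

  ≡ᵇ0 : ∀ h → (h ≡ᵇ 0) ≡ true → h ≡ 0
  ≡ᵇ0 zero _ = refl

  dyckFromRuns : ℕ → List Run → Bool
  dyckFromRuns h []             = h ≡ᵇ 0
  dyckFromRuns h ((U , k) ∷ rs) = dyckFromRuns (h + k) rs
  dyckFromRuns h ((D , k) ∷ rs) = atMost k h ∧ dyckFromRuns (h ∸ k) rs

  dyckFromRuns-pushRun-U : ∀ h L → dyckFromRuns h (pushRun U L) ≡ dyckFromRuns (suc h) L
  dyckFromRuns-pushRun-U h []             = cong (λ m → dyckFromRuns m []) (ℕ.+-comm h 1)
  dyckFromRuns-pushRun-U h ((U , k) ∷ rs) = cong (λ m → dyckFromRuns m rs) (ℕ.+-suc h k)
  dyckFromRuns-pushRun-U h ((D , k) ∷ rs) = cong (λ m → dyckFromRuns m ((D , k) ∷ rs)) (ℕ.+-comm h 1)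

  dyckFromRuns-pushRun-D : ∀ h L → dyckFromRuns (suc h) (pushRun D L) ≡ dyckFromRuns h L
  dyckFromRuns-pushRun-D h []             = refl
  dyckFromRuns-pushRun-D h ((U , k) ∷ rs) = refl
  dyckFromRuns-pushRun-D h ((D , k) ∷ rs) = refl

  dyckFromRuns-0-pushRun-D : ∀ L → dyckFromRuns 0 (pushRun D L) ≡ false
  dyckFromRuns-0-pushRun-D []             = refl
  dyckFromRuns-0-pushRun-D ((U , k) ∷ rs) = refl
  dyckFromRuns-0-pushRun-D ((D , k) ∷ rs) = refl

  dyckFrom≡dyckFromRuns : ∀ h x → dyckFrom h x ≡ dyckFromRuns h (runs x)
  dyckFrom≡dyckFromRuns zero    []      = refl
  dyckFrom≡dyckFromRuns (suc h) []      = refl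
  dyckFrom≡dyckFromRuns zero    (U ∷ x) = trans (dyckFrom≡dyckFromRuns 1 x) (sym (dyckFromRuns-pushRun-U 0 (runs x)))
  dyckFrom≡dyckFromRuns (suc h) (U ∷ x) = trans (dyckFrom≡dyckFromRuns (2 + h) x) (sym (dyckFromRuns-pushRun-U (suc h) (runs x)))
  dyckFrom≡dyckFromRuns zero    (D ∷ x) = sym (dyckFromRuns-0-pushRun-D (runs x))
  dyckFrom≡dyckFromRuns (suc h) (D ∷ x) = trans (dyckFrom≡dyckFromRuns h x) (sym (dyckFromRuns-pushRun-D h (runs x)))

  data Last (P : Mountain → Set) : List Mountain → Set where
    last  : ∀ {p}   → P p      → Last P (p ∷ [])
    there : ∀ {p K} → Last P K → Last P (p ∷ K)

  last-nonempty : ∀ {P K} → Last P K → NonEmpty K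
  last-nonempty (last _)  = nonempty
  last-nonempty (there _) = nonempty

  Ascent≤Descent Ascent<Descent : Mountain → Set
  Ascent≤Descent (i , j) = i ≤ j
  Ascent<Descent (i , j) = i < j

  -- The mountains of a primitive path U x D: a single symmetric mountain, or a first mountain
  -- longer uphill and a last mountain longer downhill.
  data LiftShape : List Mountain → Set where
    symmetric  : ∀ a → LiftShape ((a , a) ∷ [])
    asymmetric : ∀ i j K → j < i → Last Ascent<Descent K → LiftShape ((i , j) ∷ K)

  last-ascent≤descent : ∀ h {L} → UpFirst L → dyckFromRuns h L ≡ true → Last Ascent≤Descent (mountainsOfRuns L)
  last-ascent≤descent h (up i (down-end j)) ok with ∧-true (atMost j (h + i)) _ ok
  ... | _ , ends-at-0 = last (ℕ.m+n≤o⇒n≤o h (ℕ.m∸n≡0⇒m≤n (≡ᵇ0 _ ends-at-0)))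
  last-ascent≤descent h (up i (down j u)) ok with ∧-true (atMost j (h + i)) _ ok
  ... | _ , rest-ok = there (last-ascent≤descent (h + i ∸ j) u rest-ok)

  incLast-ascent<descent : ∀ {K} → Last Ascent≤Descent K → Last Ascent<Descent (incLast K)
  incLast-ascent<descent (last i≤j)          = last (s≤s i≤j)
  incLast-ascent<descent (there l@(last _))  = there (incLast-ascent<descent l)
  incLast-ascent<descent (there l@(there _)) = there (incLast-ascent<descent l)

  lift-asymmetric : ∀ {i j K} → j ≤ i → Last Ascent≤Descent K → LiftShape (lift ((i , j) ∷ K))
  lift-asymmetric {i} {j} {q ∷ M} j≤i l = asymmetric (suc i) j (incLast (q ∷ M)) (s≤s j≤i) (incLast-ascent<descent l)

  lift-shape : ∀ x → isDyck x ≡ true → LiftShape (lift (mountains x))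
  lift-shape x ok with dyck-runs x ok
  ... | inj₁ refl = symmetric 1
  ... | inj₂ u = shape u (trans (sym (dyckFrom≡dyckFromRuns 0 x)) ok)
    where
      shape : ∀ {L} → UpFirst L → dyckFromRuns 0 L ≡ true → LiftShape (lift (mountainsOfRuns L))
      shape (up i (down-end j)) runs-ok with ∧-true (atMost j i) _ runs-ok
      ... | j≤i , ends-at-0 with ℕ.≤-antisym (atMost-sound j i j≤i) (ℕ.m∸n≡0⇒m≤n (≡ᵇ0 _ ends-at-0))
      ... | refl = symmetric (suc j)
      shape (up i (down j u)) runs-ok with ∧-true (atMost j i) _ runs-ok
      ... | j≤i , rest-ok = lift-asymmetric (atMost-sound j i j≤i) (last-ascent≤descent (i ∸ j) u rest-ok)

  double : ℕ → ℕ
  double zero    = zero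
  double (suc n) = suc (suc (double n))

  double≡2* : ∀ n → double n ≡ 2 ℕ.* n
  double≡2* zero    = refl
  double≡2* (suc n) = cong suc (trans (cong suc (double≡2* n)) (sym (ℕ.+-suc n (n + 0))))

  isEven : ℕ → Bool
  isEven zero          = true
  isEven (suc zero)    = false
  isEven (suc (suc n)) = isEven n

  dyckFrom-even : ∀ h x → dyckFrom h x ≡ true → isEven (h + length x) ≡ true
  dyckFrom-even zero    []      ok = refl
  dyckFrom-even zero    (U ∷ x) ok = dyckFrom-even 1 x ok
  dyckFrom-even (suc h) (U ∷ x) ok rewrite ℕ.+-suc h (length x) = dyckFrom-even (2 + h) x ok
  dyckFrom-even (suc h) (D ∷ x) ok rewrite ℕ.+-suc h (length x) = dyckFrom-even h x ok

  odd-not-dyck : ∀ k x → length x ≡ suc (double k) → isDyck x ≡ false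
  odd-not-dyck k x |x|≡odd with isDyck x in ok
  ... | false = refl
  ... | true  = trans (sym (dyckFrom-even 0 x ok)) (trans (cong isEven |x|≡odd) (odd k))
    where
      odd : ∀ k → isEven (suc (double k)) ≡ false
      odd zero    = refl
      odd (suc k) = odd k

  totalLength : List Run → ℕ
  totalLength []            = 0
  totalLength ((_ , k) ∷ L) = k + totalLength L

  NonEmptyRun : Run → Set
  NonEmptyRun (_ , k) = 1 ≤ k

  pushRun-nonEmpty : ∀ s L → All NonEmptyRun L → All NonEmptyRun (pushRun s L) × totalLength (pushRun s L) ≡ suc (totalLength L)
  pushRun-nonEmpty s []             _        = (s≤s z≤n ∷ []) , refl
  pushRun-nonEmpty U ((U , k) ∷ L) (_ ∷ ps)  = (s≤s z≤n ∷ ps) , refl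
  pushRun-nonEmpty U ((D , k) ∷ L) ps        = (s≤s z≤n ∷ ps) , refl
  pushRun-nonEmpty D ((U , k) ∷ L) ps        = (s≤s z≤n ∷ ps) , refl
  pushRun-nonEmpty D ((D , k) ∷ L) (_ ∷ ps)  = (s≤s z≤n ∷ ps) , refl

  runs-nonEmpty : ∀ x → All NonEmptyRun (runs x) × totalLength (runs x) ≡ length x
  runs-nonEmpty []      = [] , refl
  runs-nonEmpty (s ∷ x) with runs-nonEmpty x
  ... | ps , total with pushRun-nonEmpty s (runs x) ps
  ... | ps′ , total′ = ps′ , trans total′ (cong suc total)

  Fits : ℕ → Mountain → Set
  Fits T (i , j) = 1 ≤ i × 1 ≤ j × i + j ≤ T

  fits-weaken : ∀ {T T′} → T ≤ T′ → ∀ {p} → Fits T p → Fits T′ p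
  fits-weaken T≤T′ (1≤i , 1≤j , i+j≤T) = 1≤i , 1≤j , ℕ.≤-trans i+j≤T T≤T′

  mountainsOfRuns-fit : ∀ L → All NonEmptyRun L → All (Fits (totalLength L)) (mountainsOfRuns L)
  mountainsOfRuns-fit []                          _             = []
  mountainsOfRuns-fit ((U , i) ∷ [])              _             = []
  mountainsOfRuns-fit ((U , i) ∷ (D , j) ∷ L)     (1≤i ∷ 1≤j ∷ ps) =
    (1≤i , 1≤j , ℕ.+-monoʳ-≤ i (ℕ.m≤m+n j (totalLength L))) ∷
    All.map (fits-weaken (ℕ.m≤n+m _ i)) (mountainsOfRuns-fit ((D , j) ∷ L) (1≤j ∷ ps))
  mountainsOfRuns-fit ((U , i) ∷ (U , j) ∷ L)     (_ ∷ ps)      = All.map (fits-weaken (ℕ.m≤n+m _ i)) (mountainsOfRuns-fit ((U , j) ∷ L) ps)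
  mountainsOfRuns-fit ((D , i) ∷ L)               (_ ∷ ps)      = All.map (fits-weaken (ℕ.m≤n+m _ i)) (mountainsOfRuns-fit L ps)

  WeightIn : ℕ → Mountain → Set
  WeightIn n (i , j) = 1 ≤ i ⊓ j × i ⊓ j ≤ n

  fits-weightIn : ∀ n {p} → Fits (2 ℕ.* n) p → WeightIn n p
  fits-weightIn n {suc i , suc j} (_ , _ , i+j≤2n) = s≤s z≤n ,
    ℕ.*-cancelˡ-≤ 2 (ℕ.≤-trans (ℕ.+-mono-≤ (ℕ.m⊓n≤m (suc i) (suc j)) (ℕ.+-monoˡ-≤ 0 (ℕ.m⊓n≤n (suc i) (suc j))))
                               (subst (_≤ 2 ℕ.* n) (cong (suc i +_) (sym (ℕ.+-identityʳ (suc j)))) i+j≤2n))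

  mountains-weightIn : ∀ n x → length x ≡ 2 ℕ.* n → All (WeightIn n) (mountains x)
  mountains-weightIn n x |x|≡2n with runs-nonEmpty x
  ... | ps , total = All.map (fits-weightIn n) (All.map (λ {p} → subst (λ T → Fits T p) (trans total |x|≡2n)) (mountainsOfRuns-fit (runs x) ps))

open Mountains

module DyckSums {c ℓ : Level} (R : CommutativeRing c ℓ) where
  open CommutativeRing R hiding (zero)
  open Series R
  open PowerSeries R
  open RingSolver R using (solve; _:=_; con; _:+_; _:*_; :-_)
  open import Relation.Binary.Reasoning.Setoid setoid

  given : Bool → Carrier → Carrier
  given b v = if b then v else 0#

  given-cong : ∀ b {u v} → u ≈ v → given b u ≈ given b v
  given-cong true  u≈v = u≈v
  given-cong false _   = refl

  sumList-++ : ∀ (A B : List Carrier) → sumList (A ++ B) ≈ sumList A + sumList B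
  sumList-++ []      B = sym (+-identityˡ _)
  sumList-++ (a ∷ A) B = trans (+-congˡ (sumList-++ A B)) (sym (+-assoc _ _ _))

  sumList-filter : ∀ (p : List Step → Bool) g ws → sumList (map g (filterᵇ p ws)) ≈ sumList (map (λ w → given (p w) (g w)) ws)
  sumList-filter p g []       = refl
  sumList-filter p g (w ∷ ws) with p w
  ... | true  = +-congˡ (sumList-filter p g ws)
  ... | false = trans (sumList-filter p g ws) (sym (+-identityˡ _))

  sumWords : ℕ → (List Step → Carrier) → Carrier
  sumWords zero    f = f []
  sumWords (suc k) f = sumWords k (λ w → f (U ∷ w)) + sumWords k (λ w → f (D ∷ w))

  sumList-words : ∀ k f → sumList (map f (words k)) ≈ sumWords k f
  sumList-words zero    f = +-identityʳ (f [])
  sumList-words (suc k) f = begin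
    sumList (map f (map (U ∷_) (words k) ++ map (D ∷_) (words k)))
      ≈⟨ reflexive (≡.cong sumList (List.map-++ f (map (U ∷_) (words k)) _)) ⟩
    sumList (map f (map (U ∷_) (words k)) ++ map f (map (D ∷_) (words k)))
      ≈⟨ sumList-++ (map f (map (U ∷_) (words k))) _ ⟩
    sumList (map f (map (U ∷_) (words k))) + sumList (map f (map (D ∷_) (words k)))
      ≈⟨ +-cong (reflexive (≡.cong sumList (≡.sym (List.map-∘ (words k))))) (reflexive (≡.cong sumList (≡.sym (List.map-∘ (words k))))) ⟩
    sumList (map (λ w → f (U ∷ w)) (words k)) + sumList (map (λ w → f (D ∷ w)) (words k))
      ≈⟨ +-cong (sumList-words k _) (sumList-words k _) ⟩
    sumWords (suc k) f ∎

  sumWords-cong : ∀ k {f g} → (∀ w → length w ≡ k → f w ≈ g w) → sumWords k f ≈ sumWords k g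
  sumWords-cong zero    f≈g = f≈g [] ≡.refl
  sumWords-cong (suc k) f≈g = +-cong (sumWords-cong k (λ w |w| → f≈g (U ∷ w) (≡.cong suc |w|)))
                                     (sumWords-cong k (λ w |w| → f≈g (D ∷ w) (≡.cong suc |w|)))

  sumWords-zero : ∀ k {f} → (∀ w → f w ≈ 0#) → sumWords k f ≈ 0#
  sumWords-zero zero    f≈0 = f≈0 []
  sumWords-zero (suc k) f≈0 = trans (+-cong (sumWords-zero k (λ w → f≈0 (U ∷ w))) (sumWords-zero k (λ w → f≈0 (D ∷ w)))) (+-identityʳ 0#)

  sumWords-+ : ∀ k f g → sumWords k (λ w → f w + g w) ≈ sumWords k f + sumWords k g
  sumWords-+ zero    f g = refl
  sumWords-+ (suc k) f g = trans (+-cong (sumWords-+ k _ _) (sumWords-+ k _ _))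
    (solve 4 (λ a b c d → (a :+ b) :+ (c :+ d) := (a :+ c) :+ (b :+ d)) refl _ _ _ _)

  sumWords-*ˡ : ∀ k a f → sumWords k (λ w → a * f w) ≈ a * sumWords k f
  sumWords-*ˡ zero    a f = refl
  sumWords-*ˡ (suc k) a f = trans (+-cong (sumWords-*ˡ k a _) (sumWords-*ˡ k a _)) (sym (distribˡ a _ _))

  sumWords-*ʳ : ∀ k a f → sumWords k (λ w → f w * a) ≈ sumWords k f * a
  sumWords-*ʳ k a f = trans (sumWords-cong k (λ w _ → *-comm (f w) a)) (trans (sumWords-*ˡ k a f) (*-comm a _))

  -- sumPivot m A = Σ_{j + 1 + l = m} A j l
  sumPivot : ℕ → (ℕ → ℕ → Carrier) → Carrier
  sumPivot zero    A = 0#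
  sumPivot (suc m) A = A 0 m + sumPivot m (λ j l → A (suc j) l)

  sumPivot-cong : ∀ m {A B} → (∀ j l → A j l ≈ B j l) → sumPivot m A ≈ sumPivot m B
  sumPivot-cong zero    A≈B = refl
  sumPivot-cong (suc m) A≈B = +-cong (A≈B 0 m) (sumPivot-cong m (λ j l → A≈B (suc j) l))

  sumPivot-+ : ∀ m A B → sumPivot m (λ j l → A j l + B j l) ≈ sumPivot m A + sumPivot m B
  sumPivot-+ zero    A B = sym (+-identityʳ 0#)
  sumPivot-+ (suc m) A B = trans (+-congˡ (sumPivot-+ m _ _))
    (solve 4 (λ a b c d → (a :+ b) :+ (c :+ d) := (a :+ c) :+ (b :+ d)) refl _ _ _ _)

  sumPivot-zero : ∀ m {A} → (∀ j l → A j l ≈ 0#) → sumPivot m A ≈ 0#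
  sumPivot-zero zero    A≈0 = refl
  sumPivot-zero (suc m) A≈0 = trans (+-cong (A≈0 0 m) (sumPivot-zero m (λ j l → A≈0 (suc j) l))) (+-identityʳ 0#)

  sumDyck : ℕ → (List Step → Carrier) → Carrier
  sumDyck k g = sumWords k (λ w → given (isDyck w) (g w))

  firstVisit : ℕ → (List Step → Carrier) → ℕ → ℕ → Carrier
  firstVisit c f j l = sumWords j (λ x → sumWords l (λ y → given (dyckFrom c x) (given (isDyck y) (f (x ++ D ∷ y)))))

  -- A path from height c + 1 down to 0 splits at its first visit to height 0 as x D y, where x
  -- is a path from c + 1 to 1 staying above height 0 (i.e. dyckFrom c x, one level higher) and y
  -- is a Dyck path.
  sumPivot-firstVisit : ∀ m c f → sumPivot m (firstVisit c f) ≈ sumWords m (λ w → given (dyckFrom (suc c) w) (f w))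
  sumPivot-firstVisit zero    zero    f = refl
  sumPivot-firstVisit zero    (suc c) f = refl
  sumPivot-firstVisit (suc m) zero    f = begin
    firstVisit 0 f 0 m + sumPivot m (λ j l → firstVisit 0 f (suc j) l)
      ≈⟨ +-congˡ (sumPivot-+ m _ _) ⟩
    firstVisit 0 f 0 m + (sumPivot m (firstVisit 1 (λ w → f (U ∷ w))) + sumPivot m (λ j l → sumWords j (λ x → sumWords l (λ y → 0#))))
      ≈⟨ +-congˡ (+-cong (sumPivot-firstVisit m 1 (λ w → f (U ∷ w))) (sumPivot-zero m (λ j l → sumWords-zero j (λ x → sumWords-zero l (λ y → refl))))) ⟩
    sumWords m (λ w → given (isDyck w) (f (D ∷ w))) + (sumWords m (λ w → given (dyckFrom 2 w) (f (U ∷ w))) + 0#)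
      ≈⟨ trans (+-congˡ (+-identityʳ _)) (+-comm _ _) ⟩
    sumWords m (λ w → given (dyckFrom 2 w) (f (U ∷ w))) + sumWords m (λ w → given (isDyck w) (f (D ∷ w))) ∎
  sumPivot-firstVisit (suc m) (suc c) f = begin
    firstVisit (suc c) f 0 m + sumPivot m (λ j l → firstVisit (suc c) f (suc j) l)
      ≈⟨ +-cong (sumWords-zero m (λ y → refl)) (sumPivot-+ m _ _) ⟩
    0# + (sumPivot m (firstVisit (2 ℕ.+ c) (λ w → f (U ∷ w))) + sumPivot m (firstVisit c (λ w → f (D ∷ w))))
      ≈⟨ trans (+-identityˡ _) (+-cong (sumPivot-firstVisit m (2 ℕ.+ c) _) (sumPivot-firstVisit m c _)) ⟩
    sumWords (suc m) (λ w → given (dyckFrom (2 ℕ.+ c) w) (f w)) ∎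

  sumDyck-firstReturn : ∀ m g →
    sumDyck (suc m) g ≈ sumPivot m (λ j l → sumWords j (λ x → sumWords l (λ y → given (isDyck x) (given (isDyck y) (g (U ∷ x ++ D ∷ y))))))
  sumDyck-firstReturn m g = begin
    sumWords m (λ w → given (dyckFrom 1 w) (g (U ∷ w))) + sumWords m (λ w → 0#)
      ≈⟨ trans (+-congˡ (sumWords-zero m (λ _ → refl))) (+-identityʳ _) ⟩
    sumWords m (λ w → given (dyckFrom 1 w) (g (U ∷ w)))
      ≈⟨ sym (sumPivot-firstVisit m 0 (λ w → g (U ∷ w))) ⟩
    sumPivot m (firstVisit 0 (λ w → g (U ∷ w))) ∎

  sumDyck-odd : ∀ k g → sumDyck (suc (double k)) g ≈ 0#
  sumDyck-odd k g = trans (sumWords-cong (suc (double k)) {g = λ _ → 0#}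
                             (λ w |w| → reflexive (≡.cong (λ b → given b (g w)) (odd-not-dyck k w |w|))))
                          (sumWords-zero (suc (double k)) (λ _ → refl))

  -- sumPairs n B = Σ_{k + l = n} B k l
  sumPairs : ℕ → (ℕ → ℕ → Carrier) → Carrier
  sumPairs zero    B = B 0 0
  sumPairs (suc n) B = B 0 (suc n) + sumPairs n (λ k l → B (suc k) l)

  sumPairs≈sumN : ∀ n B → sumPairs n B ≈ sumN (λ k → B k (n ∸ k)) (suc n)
  sumPairs≈sumN zero    B = sym (+-identityˡ _)
  sumPairs≈sumN (suc n) B = trans (+-congˡ (sumPairs≈sumN n _)) (sym (sumN-shift (λ k → B k (suc n ∸ k)) (suc n)))

  sumPivot-even : ∀ n A → (∀ k l → A (suc (double k)) l ≈ 0#) → sumPivot (suc (double n)) A ≈ sumPairs n (λ k l → A (double k) (double l))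
  sumPivot-even zero    A odd≈0 = +-identityʳ _
  sumPivot-even (suc n) A odd≈0 = begin
    A 0 (double (suc n)) + (A 1 (suc (double n)) + sumPivot (suc (double n)) (λ j l → A (2 ℕ.+ j) l))
      ≈⟨ +-congˡ (+-cong (odd≈0 0 _) (sumPivot-even n (λ j l → A (2 ℕ.+ j) l) (λ k l → odd≈0 (suc k) l))) ⟩
    A 0 (double (suc n)) + (0# + sumPairs n (λ k l → A (double (suc k)) (double l)))
      ≈⟨ +-congˡ (+-identityˡ _) ⟩
    sumPairs (suc n) (λ k l → A (double k) (double l)) ∎

  dyckSeries : (List Step → Carrier) → Ser
  dyckSeries g n = sumDyck (double n) g

  dyckSeries-cong : ∀ {g g′} → (∀ x → isDyck x ≡ true → g x ≈ g′ x) → dyckSeries g ≋ dyckSeries g′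
  dyckSeries-cong {g} {g′} g≈g′ n = sumWords-cong (double n) (λ w _ → pointwise w (isDyck w) ≡.refl)
    where
      pointwise : ∀ w b → isDyck w ≡ b → given b (g w) ≈ given b (g′ w)
      pointwise w true  ok = g≈g′ w ok
      pointwise w false _  = refl

  dyckSeries-+ : ∀ g g′ → dyckSeries (λ x → g x + g′ x) ≋ (dyckSeries g ⊕ dyckSeries g′)
  dyckSeries-+ g g′ n = trans (sumWords-cong (double n) (λ w _ → given-+ (isDyck w))) (sumWords-+ (double n) _ _)
    where
      given-+ : ∀ {u v} b → given b (u + v) ≈ given b u + given b v
      given-+ true  = refl
      given-+ false = sym (+-identityʳ 0#)

  dyckSeries-zero : ∀ g → (∀ x → g x ≈ 0#) → ∀ n → dyckSeries g n ≈ 0#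
  dyckSeries-zero g g≈0 n = sumWords-zero (double n) (λ w → given-zero (isDyck w))
    where
      given-zero : ∀ {w} b → given b (g w) ≈ 0#
      given-zero true  = g≈0 _
      given-zero false = refl

  sumPivot-product : ∀ n g₁ g₂ → sumPivot (suc (double n)) (λ j l → sumDyck j g₁ * sumDyck l g₂) ≈ (dyckSeries g₁ ⊛ dyckSeries g₂) n
  sumPivot-product n g₁ g₂ = begin
    sumPivot (suc (double n)) (λ j l → sumDyck j g₁ * sumDyck l g₂)
      ≈⟨ sumPivot-even n (λ j l → sumDyck j g₁ * sumDyck l g₂) (λ k l → trans (*-congʳ (sumDyck-odd k g₁)) (zeroˡ _)) ⟩
    sumPairs n (λ k l → dyckSeries g₁ k * dyckSeries g₂ l)
      ≈⟨ sumPairs≈sumN n _ ⟩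
    (dyckSeries g₁ ⊛ dyckSeries g₂) n ∎

  dyckProduct : (List Step → Carrier) → (List Step → Carrier) → List Step → List Step → Carrier
  dyckProduct g₁ g₂ x y = given (isDyck x) (g₁ x) * given (isDyck y) (g₂ y)

  sumWords-product : ∀ j l g₁ g₂ → sumWords j (λ x → sumWords l (dyckProduct g₁ g₂ x)) ≈ sumDyck j g₁ * sumDyck l g₂
  sumWords-product j l g₁ g₂ = trans (sumWords-cong j (λ x _ → sumWords-*ˡ l _ _)) (sumWords-*ʳ j _ _)

  sumWords-products : ∀ j l g₁ g₂ g₃ g₄ →
    sumWords j (λ x → sumWords l (λ y → dyckProduct g₁ g₂ x y + dyckProduct g₃ g₄ x y)) ≈ sumDyck j g₁ * sumDyck l g₂ + sumDyck j g₃ * sumDyck l g₄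
  sumWords-products j l g₁ g₂ g₃ g₄ = begin
    sumWords j (λ x → sumWords l (λ y → dyckProduct g₁ g₂ x y + dyckProduct g₃ g₄ x y))
      ≈⟨ sumWords-cong j (λ x _ → sumWords-+ l (dyckProduct g₁ g₂ x) (dyckProduct g₃ g₄ x)) ⟩
    sumWords j (λ x → sumWords l (dyckProduct g₁ g₂ x) + sumWords l (dyckProduct g₃ g₄ x))
      ≈⟨ sumWords-+ j (λ x → sumWords l (dyckProduct g₁ g₂ x)) (λ x → sumWords l (dyckProduct g₃ g₄ x)) ⟩
    sumWords j (λ x → sumWords l (dyckProduct g₁ g₂ x)) + sumWords j (λ x → sumWords l (dyckProduct g₃ g₄ x))
      ≈⟨ +-cong (sumWords-product j l g₁ g₂) (sumWords-product j l g₃ g₄) ⟩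
    sumDyck j g₁ * sumDyck l g₂ + sumDyck j g₃ * sumDyck l g₄ ∎

  dyckSeries-firstReturn : ∀ g g₁ g₂ g₃ g₄ →
    (∀ x y → isDyck x ≡ true → isDyck y ≡ true → g (U ∷ x ++ D ∷ y) ≈ g₁ x * g₂ y + g₃ x * g₄ y) →
    divZ (dyckSeries g) ≋ (dyckSeries g₁ ⊛ dyckSeries g₂ ⊕ dyckSeries g₃ ⊛ dyckSeries g₄)
  dyckSeries-firstReturn g g₁ g₂ g₃ g₄ split n = begin
    sumDyck (suc (suc (double n))) g
      ≈⟨ sumDyck-firstReturn (suc (double n)) g ⟩
    sumPivot (suc (double n)) (λ j l → sumWords j (λ x → sumWords l (λ y → given (isDyck x) (given (isDyck y) (g (U ∷ x ++ D ∷ y))))))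
      ≈⟨ sumPivot-cong (suc (double n)) (λ j l → trans (sumWords-cong j (λ x _ → sumWords-cong l (λ y _ → guarded-split x y (isDyck x) (isDyck y) ≡.refl ≡.refl)))
                                                       (sumWords-products j l g₁ g₂ g₃ g₄)) ⟩
    sumPivot (suc (double n)) (λ j l → sumDyck j g₁ * sumDyck l g₂ + sumDyck j g₃ * sumDyck l g₄)
      ≈⟨ sumPivot-+ (suc (double n)) (λ j l → sumDyck j g₁ * sumDyck l g₂) (λ j l → sumDyck j g₃ * sumDyck l g₄) ⟩
    sumPivot (suc (double n)) (λ j l → sumDyck j g₁ * sumDyck l g₂) + sumPivot (suc (double n)) (λ j l → sumDyck j g₃ * sumDyck l g₄)
      ≈⟨ +-cong (sumPivot-product n g₁ g₂) (sumPivot-product n g₃ g₄) ⟩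
    (dyckSeries g₁ ⊛ dyckSeries g₂ ⊕ dyckSeries g₃ ⊛ dyckSeries g₄) n ∎
    where
      guarded-split : ∀ x y a b → isDyck x ≡ a → isDyck y ≡ b →
        given a (given b (g (U ∷ x ++ D ∷ y))) ≈ given a (g₁ x) * given b (g₂ y) + given a (g₃ x) * given b (g₄ y)
      guarded-split x y true  true  x-ok y-ok = split x y x-ok y-ok
      guarded-split x y true  false _    _    = sym (trans (+-cong (zeroʳ _) (zeroʳ _)) (+-identityʳ 0#))
      guarded-split x y false b     _    _    = sym (trans (+-cong (zeroˡ _) (zeroˡ _)) (+-identityʳ 0#))

  dyckSeries-firstReturn₁ : ∀ g g₁ g₂ →
    (∀ x y → isDyck x ≡ true → isDyck y ≡ true → g (U ∷ x ++ D ∷ y) ≈ g₁ x * g₂ y) →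
    divZ (dyckSeries g) ≋ (dyckSeries g₁ ⊛ dyckSeries g₂)
  dyckSeries-firstReturn₁ g g₁ g₂ split n = begin
    dyckSeries g (suc n)
      ≈⟨ dyckSeries-firstReturn g g₁ g₂ (λ _ → 0#) (λ _ → 0#)
           (λ x y x-ok y-ok → trans (split x y x-ok y-ok) (sym (trans (+-congˡ (zeroˡ 0#)) (+-identityʳ _)))) n ⟩
    (dyckSeries g₁ ⊛ dyckSeries g₂) n + (dyckSeries (λ _ → 0#) ⊛ dyckSeries (λ _ → 0#)) n
      ≈⟨ trans (+-congˡ (⊛-zeroˡ (dyckSeries (λ _ → 0#)) (dyckSeries (λ _ → 0#)) (dyckSeries-zero _ (λ _ → refl)) n)) (+-identityʳ _) ⟩
    (dyckSeries g₁ ⊛ dyckSeries g₂) n ∎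

module PeakWeights {c ℓ : Level} (R : CommutativeRing c ℓ) (t r : ℕ → CommutativeRing.Carrier R) where
  open CommutativeRing R hiding (zero)
  open Series R
  open PowerSeries R
  open DyckSums R
  open RingSolver R using (solve; _:=_; con; _:+_; _:*_; :-_)
  open import Relation.Binary.Reasoning.Setoid setoid

  mountainWeight : Mountain → Carrier
  mountainWeight (i , j) = if i ≡ᵇ j then t (i ⊓ j) else r (i ⊓ j)

  weight : List Mountain → Carrier
  weight []      = 1#
  weight (p ∷ M) = mountainWeight p * weight M

  weight-++ : ∀ A B → weight (A ++ B) ≈ weight A * weight B
  weight-++ []      B = sym (*-identityˡ _)
  weight-++ (p ∷ A) B = trans (*-congˡ (weight-++ A B)) (sym (*-assoc _ _ _))

  mountainWeight-symmetric : ∀ a → mountainWeight (a , a) ≡ t a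
  mountainWeight-symmetric a rewrite ≡ᵇ-refl a | ℕ.⊓-idem a = ≡.refl

  mountainWeight-> : ∀ {i j} → j < i → mountainWeight (i , j) ≡ r j
  mountainWeight-> {i} {j} j<i rewrite ≢⇒≡ᵇ-false (ℕ.>⇒≢ j<i) = ≡.cong r (ℕ.m≥n⇒m⊓n≡n (ℕ.<⇒≤ j<i))

  mountainWeight-< : ∀ {i j} → i < j → mountainWeight (i , j) ≡ r i
  mountainWeight-< {i} {j} i<j rewrite ≢⇒≡ᵇ-false (ℕ.<⇒≢ i<j) = ≡.cong r (ℕ.m≤n⇒m⊓n≡m (ℕ.<⇒≤ i<j))

  weight-incLast : ∀ {K} → Last Ascent<Descent K → weight (incLast K) ≈ weight K
  weight-incLast (last {i , j} i<j) =
    *-congʳ (reflexive (≡.trans (mountainWeight-< (ℕ.m<n⇒m<1+n i<j)) (≡.sym (mountainWeight-< i<j))))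
  weight-incLast (there l@(last _))  = *-congˡ (weight-incLast l)
  weight-incLast (there l@(there _)) = *-congˡ (weight-incLast l)

  pyramid : (ℕ → Carrier) → List Mountain → Carrier
  pyramid g []                = 0#
  pyramid g ((i , j) ∷ [])    = if i ≡ᵇ j then g i else 0#
  pyramid g (_ ∷ _ ∷ _)       = 0#

  pyramid-symmetric : ∀ g a → pyramid g ((a , a) ∷ []) ≡ g a
  pyramid-symmetric g a rewrite ≡ᵇ-refl a = ≡.refl

  pyramid-∷ : ∀ g p {K} → NonEmpty K → pyramid g (p ∷ K) ≡ 0#
  pyramid-∷ g p nonempty = ≡.refl

  pyramid-difference : ∀ g g′ L → pyramid g L - pyramid g′ L ≈ pyramid (λ a → g a - g′ a) L
  pyramid-difference g g′ []                = -‿inverseʳ 0#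
  pyramid-difference g g′ ((i , j) ∷ []) with i ≡ᵇ j
  ... | true  = refl
  ... | false = -‿inverseʳ 0#
  pyramid-difference g g′ (_ ∷ _ ∷ _)       = -‿inverseʳ 0#

  ifEmpty : List Mountain → Carrier
  ifEmpty []      = 1#
  ifEmpty (_ ∷ _) = 0#

  Δr Δt : ℕ → Carrier
  Δr a = r a - t a
  Δt a = t (suc a) - t a

  private
    x≈y+[x-y] : ∀ x y → x ≈ y + (x - y)
    x≈y+[x-y] = solve 2 (λ x y → x := y :+ (x :+ (:- y))) refl

  weight-incFirst : ∀ {L} → LiftShape L → weight (incFirst L) ≈ weight L + pyramid Δr L
  weight-incFirst (symmetric a) rewrite mountainWeight-> (ℕ.n<1+n a) | mountainWeight-symmetric a | pyramid-symmetric Δr a =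
    trans (*-identityʳ _) (trans (x≈y+[x-y] (r a) (t a)) (+-congʳ (sym (*-identityʳ _))))
  weight-incFirst (asymmetric i j K j<i l) rewrite pyramid-∷ Δr (i , j) (last-nonempty l) =
    trans (*-congʳ (reflexive (≡.trans (mountainWeight-> (ℕ.m<n⇒m<1+n j<i)) (≡.sym (mountainWeight-> j<i))))) (sym (+-identityʳ _))

  weight-incLast-lifted : ∀ {L} → LiftShape L → weight (incLast L) ≈ weight L + pyramid Δr L
  weight-incLast-lifted (symmetric a) rewrite mountainWeight-< (ℕ.n<1+n a) | mountainWeight-symmetric a | pyramid-symmetric Δr a =
    trans (*-identityʳ _) (trans (x≈y+[x-y] (r a) (t a)) (+-congʳ (sym (*-identityʳ _))))
  weight-incLast-lifted (asymmetric i j K j<i l) rewrite pyramid-∷ Δr (i , j) (last-nonempty l) | incLast-∷ (i , j) (last-nonempty l) =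
    trans (*-congˡ (weight-incLast l)) (sym (+-identityʳ _))

  weight-lift : ∀ {L} → LiftShape L → weight (lift L) ≈ weight L + pyramid Δt L
  weight-lift (symmetric a) rewrite mountainWeight-symmetric (suc a) | mountainWeight-symmetric a | pyramid-symmetric Δt a =
    trans (*-identityʳ _) (trans (x≈y+[x-y] (t (suc a)) (t a)) (+-congʳ (sym (*-identityʳ _))))
  weight-lift (asymmetric i j K j<i l) rewrite pyramid-∷ Δt (i , j) (last-nonempty l) | incLast-∷ (suc i , j) (last-nonempty l) =
    trans (*-cong (reflexive (≡.trans (mountainWeight-> (ℕ.m<n⇒m<1+n j<i)) (≡.sym (mountainWeight-> j<i)))) (weight-incLast l))
          (sym (+-identityʳ _))

  pyramid-lift-++ : ∀ g L M → NonEmpty L → pyramid g (lift (L ++ M)) ≈ pyramid (λ a → g (suc a)) L * ifEmpty M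
  pyramid-lift-++ g (p ∷ [])    [] nonempty = sym (*-identityʳ _)
  pyramid-lift-++ g (p ∷ q ∷ A) [] nonempty rewrite List.++-identityʳ A | pyramid-∷ g (incUp p) (incLast-nonempty q A) = sym (zeroˡ _)
  pyramid-lift-++ g (p ∷ A) (q ∷ M) nonempty rewrite lift-++ p A q M | pyramid-∷ g (incUp p) (++-nonemptyʳ A (incLast-nonempty q M)) = sym (zeroʳ _)

  weight-incLast-++ : ∀ L M → weight (incLast (L ++ M)) ≈ weight L * weight (incLast M) + (weight (incLast L) - weight L) * ifEmpty M
  weight-incLast-++ L [] rewrite List.++-identityʳ L =
    sym (trans (+-cong (*-identityʳ _) (*-identityʳ _)) (solve 2 (λ x y → y :+ (x :+ (:- y)) := x) refl _ _))
  weight-incLast-++ L (q ∷ M) rewrite incLast-++ L q M =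
    trans (weight-++ L (incLast (q ∷ M))) (sym (trans (+-congˡ (zeroʳ _)) (+-identityʳ _)))

  weight-lift-++ : ∀ L M → NonEmpty L →
    weight (lift (L ++ M)) ≈ weight (incFirst L) * weight (incLast M) + (weight (lift L) - weight (incFirst L)) * ifEmpty M
  weight-lift-++ (p ∷ A) [] nonempty rewrite List.++-identityʳ A =
    sym (trans (+-cong (*-identityʳ _) (*-identityʳ _)) (solve 2 (λ x y → y :+ (x :+ (:- y)) := x) refl _ _))
  weight-lift-++ (p ∷ A) (q ∷ M) nonempty rewrite lift-++ p A q M =
    trans (weight-++ (incFirst (p ∷ A)) (incLast (q ∷ M))) (sym (trans (+-congˡ (zeroʳ _)) (+-identityʳ _)))

  -- The peak predicates of sp and ap are anonymous functions in Defs: they enter as parameters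
  -- fixed by their values, and are instantiated by unification.
  module _ (n : ℕ) (isSym isAsym : ℕ → Mountain → Bool)
           (isSym-def  : ∀ k a b → isSym k (a , b) ≡ ((a ≡ᵇ b) ∧ (a ≡ᵇ k)))
           (isAsym-def : ∀ k a b → isAsym k (a , b) ≡ (not (a ≡ᵇ b) ∧ ((a ⊓ b) ≡ᵇ k))) where

    factor : Mountain → ℕ → Carrier
    factor m i = pow (t i) (indicator (isSym i m)) * pow (r i) (indicator (isAsym i m))

    factors : List Mountain → ℕ → Carrier
    factors M i = pow (t i) (count (isSym i) M) * pow (r i) (count (isAsym i) M)

    factors-∷ : ∀ m M i → factors (m ∷ M) i ≈ factor m i * factors M i
    factors-∷ m M i = begin
      pow (t i) (count (isSym i) (m ∷ M)) * pow (r i) (count (isAsym i) (m ∷ M))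
        ≈⟨ reflexive (≡.cong₂ (λ u v → pow (t i) u * pow (r i) v) (count-∷ (isSym i) m M) (count-∷ (isAsym i) m M)) ⟩
      pow (t i) (indicator (isSym i m) ℕ.+ count (isSym i) M) * pow (r i) (indicator (isAsym i m) ℕ.+ count (isAsym i) M)
        ≈⟨ *-cong (pow-+ (t i) (indicator (isSym i m)) _) (pow-+ (r i) (indicator (isAsym i m)) _) ⟩
      (pow (t i) (indicator (isSym i m)) * pow (t i) (count (isSym i) M)) * (pow (r i) (indicator (isAsym i m)) * pow (r i) (count (isAsym i) M))
        ≈⟨ solve 4 (λ p q u v → (p :* q) :* (u :* v) := (p :* u) :* (q :* v)) refl _ _ _ _ ⟩
      factor m i * factors M i ∎

    prodFrom1-factor : ∀ a b → WeightIn n (a , b) → prodFrom1 (factor (a , b)) n ≈ mountainWeight (a , b)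
    prodFrom1-factor a b weight-in =
      trans (prodFrom1-cong n (λ i → reflexive (≡.cong₂ (λ u v → pow (t i) (indicator u) * pow (r i) (indicator v)) (isSym-def i a b) (isAsym-def i a b))))
            (by-symmetry (a ≡ᵇ b) ≡.refl weight-in)
      where
        by-symmetry : ∀ e → (a ≡ᵇ b) ≡ e → WeightIn n (a , b) →
          prodFrom1 (λ i → pow (t i) (indicator (e ∧ (a ≡ᵇ i))) * pow (r i) (indicator (not e ∧ ((a ⊓ b) ≡ᵇ i)))) n ≈ (if e then t (a ⊓ b) else r (a ⊓ b))
        by-symmetry true a≡ᵇb (1≤min , min≤n) with ℕ.≡ᵇ⇒≡ a b (≡.subst T (≡.sym a≡ᵇb) tt)
        ... | ≡.refl rewrite ℕ.⊓-idem a = trans (prodFrom1-cong n (λ i → *-identityʳ _)) (prodFrom1-at n t a 1≤min min≤n)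
        by-symmetry false _ (1≤min , min≤n) = trans (prodFrom1-cong n (λ i → *-identityˡ _)) (prodFrom1-at n r (a ⊓ b) 1≤min min≤n)

    prodFrom1-factors : ∀ M → All (WeightIn n) M → prodFrom1 (factors M) n ≈ weight M
    prodFrom1-factors []            []          = prodFrom1-one _ n (λ i _ → *-identityˡ 1#)
    prodFrom1-factors ((a , b) ∷ M) (w-in ∷ ws) = begin
      prodFrom1 (factors ((a , b) ∷ M)) n                                        ≈⟨ prodFrom1-cong n (factors-∷ (a , b) M) ⟩
      prodFrom1 (λ i → factor (a , b) i * factors M i) n                        ≈⟨ prodFrom1-* (factor (a , b)) (factors M) n ⟩
      prodFrom1 (factor (a , b)) n * prodFrom1 (factors M) n                     ≈⟨ *-cong (prodFrom1-factor a b w-in) (prodFrom1-factors M ws) ⟩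
      mountainWeight (a , b) * weight M                                          ∎

  pathWeight≈weight : ∀ n w → length w ≡ 2 ℕ.* n → pathWeight t r n w ≈ weight (mountains w)
  pathWeight≈weight n w |w|≡2n = prodFrom1-factors n _ _ (λ _ _ _ → ≡.refl) (λ _ _ _ → ≡.refl) (mountains w) (mountains-weightIn n w |w|≡2n)

module WeightSeries {c ℓ : Level} (R : CommutativeRing c ℓ) (t r : ℕ → CommutativeRing.Carrier R) where
  open CommutativeRing R hiding (zero)
  open Series R
  open PowerSeries R
  open DyckSums R
  open PeakWeights R t r
  open RingSolver R using (solve; _:=_; con; _:+_; _:*_; :-_)
  open import Relation.Binary.Reasoning.Setoid setoid

  1ₘ : Ser
  1ₘ = dyckSeries (ifEmpty ∘ mountains)

  1ₘ≋1ₛ : 1ₘ ≋ 1ₛ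
  1ₘ≋1ₛ zero    = refl
  1ₘ≋1ₛ (suc n) = trans (dyckSeries-firstReturn₁ (ifEmpty ∘ mountains) (λ _ → 0#) (λ _ → 0#) split n)
                       (⊛-zeroˡ (dyckSeries (λ _ → 0#)) (dyckSeries (λ _ → 0#)) (dyckSeries-zero (λ _ → 0#) (λ _ → refl)) n)
    where
      split : ∀ x y → isDyck x ≡ true → isDyck y ≡ true → ifEmpty (mountains (U ∷ x ++ D ∷ y)) ≈ 0# * 0#
      split x y x-ok y-ok rewrite mountains-firstReturn x y x-ok y-ok with lift (mountains x) | lift-nonempty (mountains x)
      ... | _ ∷ _ | nonempty = sym (zeroˡ 0#)

  pyramid-series : ∀ g n → dyckSeries (λ x → pyramid g (lift (mountains x))) n ≈ g (suc n)
  pyramid-series g zero    = refl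
  pyramid-series g (suc n) = begin
    dyckSeries (λ x → pyramid g (lift (mountains x))) (suc n)
      ≈⟨ dyckSeries-firstReturn₁ (λ x → pyramid g (lift (mountains x))) (λ x → pyramid g′ (lift (mountains x))) (ifEmpty ∘ mountains) split n ⟩
    (P′ ⊛ 1ₘ) n
      ≈⟨ ⊛-cong {P′} {P′} {1ₘ} {1ₛ} (λ _ → refl) 1ₘ≋1ₛ n ⟩
    (P′ ⊛ 1ₛ) n
      ≈⟨ ⊛-1ₛ P′ n ⟩
    P′ n
      ≈⟨ pyramid-series g′ n ⟩
    g (2 ℕ.+ n) ∎
    where
      g′ : ℕ → Carrier
      g′ a = g (suc a)
      P′ : Ser
      P′ = dyckSeries (λ x → pyramid g′ (lift (mountains x)))
      split : ∀ x y → isDyck x ≡ true → isDyck y ≡ true →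
              pyramid g (lift (mountains (U ∷ x ++ D ∷ y))) ≈ pyramid g′ (lift (mountains x)) * ifEmpty (mountains y)
      split x y x-ok y-ok rewrite mountains-firstReturn x y x-ok y-ok = pyramid-lift-++ g _ _ (lift-nonempty (mountains x))

  weightOf : (List Mountain → List Mountain) → List Step → Carrier
  weightOf f x = weight (f (mountains x))

  _∸ʷ_ : (List Mountain → List Mountain) → (List Mountain → List Mountain) → List Step → Carrier
  (f ∸ʷ g) x = weightOf f x - weightOf g x

  F A E : Ser
  F = dyckSeries (weightOf id)
  A = dyckSeries (weightOf lift)
  E = dyckSeries (weightOf incLast)

  F-firstReturn : divZ F ≋ (A ⊛ F)
  F-firstReturn = dyckSeries-firstReturn₁ (weightOf id) (weightOf lift) (weightOf id) split
    where
      split : ∀ x y → isDyck x ≡ true → isDyck y ≡ true → weightOf id (U ∷ x ++ D ∷ y) ≈ weightOf lift x * weightOf id y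
      split x y x-ok y-ok rewrite mountains-firstReturn x y x-ok y-ok = weight-++ (lift (mountains x)) (mountains y)

  E-firstReturn : divZ E ≋ (A ⊛ E ⊕ dyckSeries ((incLast ∘ lift) ∸ʷ lift) ⊛ 1ₘ)
  E-firstReturn = dyckSeries-firstReturn (weightOf incLast) (weightOf lift) (weightOf incLast) ((incLast ∘ lift) ∸ʷ lift) (ifEmpty ∘ mountains) split
    where
      split : ∀ x y → isDyck x ≡ true → isDyck y ≡ true →
              weightOf incLast (U ∷ x ++ D ∷ y) ≈ weightOf lift x * weightOf incLast y + ((incLast ∘ lift) ∸ʷ lift) x * ifEmpty (mountains y)
      split x y x-ok y-ok rewrite mountains-firstReturn x y x-ok y-ok = weight-incLast-++ (lift (mountains x)) (mountains y)

  A-firstReturn : divZ A ≋ (dyckSeries (weightOf (incFirst ∘ lift)) ⊛ E ⊕ dyckSeries ((lift ∘ lift) ∸ʷ (incFirst ∘ lift)) ⊛ 1ₘ)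
  A-firstReturn = dyckSeries-firstReturn (weightOf lift) (weightOf (incFirst ∘ lift)) (weightOf incLast) ((lift ∘ lift) ∸ʷ (incFirst ∘ lift)) (ifEmpty ∘ mountains) split
    where
      split : ∀ x y → isDyck x ≡ true → isDyck y ≡ true →
              weightOf lift (U ∷ x ++ D ∷ y) ≈ weightOf (incFirst ∘ lift) x * weightOf incLast y + ((lift ∘ lift) ∸ʷ (incFirst ∘ lift)) x * ifEmpty (mountains y)
      split x y x-ok y-ok rewrite mountains-firstReturn x y x-ok y-ok = weight-lift-++ (lift (mountains x)) (mountains y) (lift-nonempty (mountains x))

  ΔrSeries : Ser
  ΔrSeries = divZ (P r ⊖ P t)

  -- τ n = Δt (n + 1) - Δr (n + 1)
  τ : Ser
  τ n = t (2 ℕ.+ n) - r (suc n)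

  D-series : dyckSeries ((incLast ∘ lift) ∸ʷ lift) ≋ ΔrSeries
  D-series n = trans (dyckSeries-cong (λ x ok → trans (+-congʳ (weight-incLast-lifted (lift-shape x ok)))
                                                      (solve 2 (λ a b → (a :+ b) :+ (:- a) := b) refl _ _)) n)
                     (pyramid-series Δr n)

  C-series : dyckSeries ((lift ∘ lift) ∸ʷ (incFirst ∘ lift)) ≋ τ
  C-series n = begin
    dyckSeries ((lift ∘ lift) ∸ʷ (incFirst ∘ lift)) n
      ≈⟨ dyckSeries-cong (λ x ok → trans (+-cong (weight-lift (lift-shape x ok)) (-‿cong (weight-incFirst (lift-shape x ok))))
                                         (trans (solve 3 (λ a b c → (a :+ b) :+ (:- (a :+ c)) := b :+ (:- c)) refl _ _ _) (pyramid-difference Δt Δr (lift (mountains x))))) n ⟩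
    dyckSeries (λ x → pyramid (λ a → Δt a - Δr a) (lift (mountains x))) n
      ≈⟨ pyramid-series _ n ⟩
    Δt (suc n) - Δr (suc n)
      ≈⟨ solve 3 (λ a b c → (a :+ (:- b)) :+ (:- (c :+ (:- b))) := a :+ (:- c)) refl _ _ _ ⟩
    τ n ∎

  B-series : dyckSeries (weightOf (incFirst ∘ lift)) ≋ (A ⊕ ΔrSeries)
  B-series n = trans (dyckSeries-cong (λ x ok → weight-incFirst (lift-shape x ok)) n)
                     (trans (dyckSeries-+ (weightOf lift) (λ x → pyramid Δr (lift (mountains x))) n) (+-congˡ (pyramid-series Δr n)))

  z-⊛-z-⊛-τ : z ⊛ (z ⊛ τ) ≈ₛ P t ⊖ z ⊛ const (t 1) ⊖ z ⊛ P r
  z-⊛-z-⊛-τ = mk coefficient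
    where
      rhs≈ : ∀ n {a b c} → (z ⊛ const (t 1)) n ≈ b → (z ⊛ P r) n ≈ c → P t n ≡ a →
             (P t ⊖ z ⊛ const (t 1) ⊖ z ⊛ P r) n ≈ (a - b) - c
      rhs≈ n b≈ c≈ ≡.refl = +-cong (+-congˡ (-‿cong b≈)) (-‿cong c≈)

      coefficient : ∀ n → (z ⊛ (z ⊛ τ)) n ≈ (P t ⊖ z ⊛ const (t 1) ⊖ z ⊛ P r) n
      coefficient zero =
        trans (z-⊛-zero (z ⊛ τ))
              (sym (trans (rhs≈ 0 (z-⊛-zero (const (t 1))) (z-⊛-zero (P r)) ≡.refl)
                          (solve 0 (con (0 , 0) :+ (:- con (0 , 0)) :+ (:- con (0 , 0)) := con (0 , 0)) refl)))
      coefficient (suc zero) =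
        trans (z-⊛-suc (z ⊛ τ) 0)
              (trans (z-⊛-zero τ)
                     (sym (trans (rhs≈ 1 (z-⊛-suc (const (t 1)) 0) (z-⊛-suc (P r) 0) ≡.refl)
                                 (solve 1 (λ a → a :+ (:- a) :+ (:- con (0 , 0)) := con (0 , 0)) refl (t 1)))))
      coefficient (suc (suc m)) =
        trans (z-⊛-suc (z ⊛ τ) (suc m))
              (trans (z-⊛-suc τ m)
                     (sym (trans (rhs≈ (2 ℕ.+ m) (z-⊛-suc (const (t 1)) (suc m)) (z-⊛-suc (P r) (suc m)) ≡.refl)
                                 (solve 2 (λ a b → a :+ (:- con (0 , 0)) :+ (:- b) := a :+ (:- b)) refl (t (2 ℕ.+ m)) (r (suc m))))))

  dyckGF≋F : dyckGF t r ≋ F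
  dyckGF≋F n = begin
    sumList (map (pathWeight t r n) (filterᵇ isDyck (words (2 ℕ.* n))))
      ≈⟨ sumList-filter isDyck (pathWeight t r n) (words (2 ℕ.* n)) ⟩
    sumList (map (λ w → given (isDyck w) (pathWeight t r n w)) (words (2 ℕ.* n)))
      ≈⟨ sumList-words (2 ℕ.* n) _ ⟩
    sumWords (2 ℕ.* n) (λ w → given (isDyck w) (pathWeight t r n w))
      ≈⟨ reflexive (≡.cong (λ k → sumWords k (λ w → given (isDyck w) (pathWeight t r n w))) (≡.sym (double≡2* n))) ⟩
    sumWords (double n) (λ w → given (isDyck w) (pathWeight t r n w))
      ≈⟨ sumWords-cong (double n) (λ w |w| → given-cong (isDyck w) (pathWeight≈weight n w (≡.trans |w| (double≡2* n)))) ⟩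
    F n ∎

module FunctionalEquations {c ℓ : Level} (R : CommutativeRing c ℓ) (t r : ℕ → CommutativeRing.Carrier R) where
  open CommutativeRing R hiding (zero)
  open Series R
  open PowerSeries R
  open DyckSums R
  open PeakWeights R t r
  open WeightSeries R t r
  module S = CommutativeRing seriesRing
  open RingSolver seriesRing using (solve; _:=_; con; _:+_; _:*_; :-_)
  open import Relation.Binary.Reasoning.Setoid S.setoid

  G : Ser
  G = z ⊛ A

  F-equation : F ≈ₛ 1ₛ ⊕ G ⊛ F
  F-equation = S.trans (mk (≋-const⊕z⊛ F (A ⊛ F) 1# refl F-firstReturn)) (⊕-congˡ 1ₛ (S.sym (S.*-assoc z A F)))

  z-⊛-ΔrSeries : z ⊛ ΔrSeries ≈ₛ P r ⊖ P t
  z-⊛-ΔrSeries = mk (z-⊛-divZ (P r ⊖ P t) (-‿inverseʳ 0#))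

  ⊛-1ₘ : ∀ f → f ⊛ 1ₘ ≈ₛ f
  ⊛-1ₘ f = mk (λ n → trans (⊛-cong {f} {f} {1ₘ} {1ₛ} (λ _ → refl) 1ₘ≋1ₛ n) (⊛-1ₛ f n))

  E-equation : E ≈ₛ 1ₛ ⊕ G ⊛ E ⊕ (P r ⊖ P t)
  E-equation = begin
    E
      ≈⟨ mk (≋-const⊕z⊛ E _ 1# refl E-firstReturn) ⟩
    1ₛ ⊕ z ⊛ (A ⊛ E ⊕ dyckSeries ((incLast ∘ lift) ∸ʷ lift) ⊛ 1ₘ)
      ≈⟨ ⊕-congˡ 1ₛ (⊛-congˡ z (⊕-congˡ (A ⊛ E) (S.trans (⊛-1ₘ _) (mk D-series)))) ⟩
    1ₛ ⊕ z ⊛ (A ⊛ E ⊕ ΔrSeries)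
      ≈⟨ solve 5 (λ o Z a e d → o :+ Z :* (a :* e :+ d) := o :+ (Z :* a) :* e :+ Z :* d) S.refl 1ₛ z A E ΔrSeries ⟩
    1ₛ ⊕ G ⊛ E ⊕ z ⊛ ΔrSeries
      ≈⟨ ⊕-congˡ (1ₛ ⊕ G ⊛ E) z-⊛-ΔrSeries ⟩
    1ₛ ⊕ G ⊛ E ⊕ (P r ⊖ P t) ∎

  G-equation : G ≈ₛ z ⊛ (G ⊕ P r ⊖ P t) ⊛ E ⊕ P t ⊖ z ⊛ P r
  G-equation = begin
    z ⊛ A
      ≈⟨ ⊛-congˡ z (mk (≋-const⊕z⊛ A _ (t 1) (*-identityʳ (t 1)) A-firstReturn)) ⟩
    z ⊛ (c₁ ⊕ z ⊛ (dyckSeries (weightOf (incFirst ∘ lift)) ⊛ E ⊕ dyckSeries ((lift ∘ lift) ∸ʷ (incFirst ∘ lift)) ⊛ 1ₘ))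
      ≈⟨ ⊛-congˡ z (⊕-congˡ c₁ (⊛-congˡ z (S.+-cong (⊛-congʳ E (mk B-series)) (S.trans (⊛-1ₘ _) (mk C-series))))) ⟩
    z ⊛ (c₁ ⊕ z ⊛ ((A ⊕ ΔrSeries) ⊛ E ⊕ τ))
      ≈⟨ solve 6 (λ Z c a d e T → Z :* (c :+ Z :* ((a :+ d) :* e :+ T)) := Z :* c :+ Z :* (Z :* a :+ Z :* d) :* e :+ Z :* (Z :* T)) S.refl z c₁ A ΔrSeries E τ ⟩
    z ⊛ c₁ ⊕ z ⊛ (G ⊕ z ⊛ ΔrSeries) ⊛ E ⊕ z ⊛ (z ⊛ τ)
      ≈⟨ S.+-cong (⊕-congˡ (z ⊛ c₁) (⊛-congʳ E (⊛-congˡ z (⊕-congˡ G z-⊛-ΔrSeries)))) z-⊛-z-⊛-τ ⟩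
    z ⊛ c₁ ⊕ z ⊛ (G ⊕ (P r ⊖ P t)) ⊛ E ⊕ (P t ⊖ z ⊛ c₁ ⊖ z ⊛ P r)
      ≈⟨ solve 6 (λ Z c g pr pt e → Z :* c :+ Z :* (g :+ (pr :+ (:- pt))) :* e :+ (pt :+ (:- (Z :* c)) :+ (:- (Z :* pr)))
                                    := Z :* (g :+ pr :+ (:- pt)) :* e :+ pt :+ (:- (Z :* pr))) S.refl z c₁ G (P r) (P t) E ⟩
    z ⊛ (G ⊕ P r ⊖ P t) ⊛ E ⊕ P t ⊖ z ⊛ P r ∎
    where
      c₁ : Ser
      c₁ = const (t 1)

module ClosedForm {c ℓ : Level} (R : CommutativeRing c ℓ) (t r : ℕ → CommutativeRing.Carrier R) where
  open CommutativeRing R using (Carrier; _≈_; _+_; _*_; 1#; 0#)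
  open Series R
  open PowerSeries R
  module R = CommutativeRing R
  open CommutativeRing seriesRing using (refl; sym; trans; +-cong; *-cong; -‿cong; +-identityˡ; *-identityˡ; *-identityʳ; -‿inverseʳ; setoid)
  open RingSolver seriesRing using (solve; _:=_; con; _:+_; _:*_; :-_)
  open import Relation.Binary.Reasoning.Setoid setoid

  Q : Ser
  Q = 1ₛ ⊖ P t ⊕ P r

  two : Ser
  two = 1ₛ ⊕ 1ₛ

  X[_] B[_] Δ[_] : Ser → Ser
  X[ w ] = 1ₛ ⊖ P t ⊕ w ⊛ P r
  B[ w ] = 1ₛ ⊕ z ⊖ (1ₛ ⊕ z) ⊛ P t ⊕ w ⊛ z ⊛ P r
  Δ[ w ] = (1ₛ ⊖ z) ⊛ ((1ₛ ⊖ P t) ⊛ (1ₛ ⊖ P t) ⊖ z ⊛ X[ w ] ⊛ X[ w ])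

  X-cong : ∀ {w w′} → w ≈ₛ w′ → X[ w ] ≈ₛ X[ w′ ]
  X-cong w≈w′ = ⊕-congˡ (1ₛ ⊖ P t) (⊛-congʳ (P r) w≈w′)

  B-cong : ∀ {w w′} → w ≈ₛ w′ → B[ w ] ≈ₛ B[ w′ ]
  B-cong w≈w′ = ⊕-congˡ (1ₛ ⊕ z ⊖ (1ₛ ⊕ z) ⊛ P t) (⊛-congʳ (P r) (⊛-congʳ z w≈w′))

  Δ-cong : ∀ {w w′} → w ≈ₛ w′ → Δ[ w ] ≈ₛ Δ[ w′ ]
  Δ-cong w≈w′ = ⊛-congˡ (1ₛ ⊖ z) (⊕-congˡ ((1ₛ ⊖ P t) ⊛ (1ₛ ⊖ P t)) (-‿cong (*-cong (⊛-congˡ z (X-cong w≈w′)) (X-cong w≈w′))))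

  const2≈two : const (1# + 1#) ≈ₛ two
  const2≈two = mk λ { zero → R.refl ; (suc n) → R.sym (R.+-identityʳ 0#) }

  module _ (h : Carrier) (2h≈1 : (1# + 1#) * h ≈ 1#) (F G E : Ser) (G₀≈0 : G 0 ≈ 0#)
           (F-equation : F ≈ₛ 1ₛ ⊕ G ⊛ F)
           (E-equation : E ≈ₛ 1ₛ ⊕ G ⊛ E ⊕ (P r ⊖ P t))
           (G-equation : G ≈ₛ z ⊛ (G ⊕ P r ⊖ P t) ⊛ E ⊕ P t ⊖ z ⊛ P r)
           where

    ≈⇒⊖≈0 : ∀ {f g} → f ≈ₛ g → f ⊖ g ≈ₛ 0ₛ
    ≈⇒⊖≈0 {f} {g} f≈g = trans (⊕-congˡ f (-‿cong (sym f≈g))) (-‿inverseʳ f)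

    -- E − Q F is a fixed point of multiplication by G.
    E≈QF : E ≈ₛ Q ⊛ F
    E≈QF = begin
      E                           ≈⟨ solve 2 (λ e q → e := (e :+ (:- q)) :+ q) refl E (Q ⊛ F) ⟩
      (E ⊖ Q ⊛ F) ⊕ Q ⊛ F         ≈⟨ ⊕-congʳ (Q ⊛ F) (mk (fixpoint≋0 (E ⊖ Q ⊛ F) G (un fixed) G₀≈0)) ⟩
      0ₛ ⊕ Q ⊛ F                  ≈⟨ +-identityˡ (Q ⊛ F) ⟩
      Q ⊛ F                       ∎
      where
        fixed : E ⊖ Q ⊛ F ≈ₛ G ⊛ (E ⊖ Q ⊛ F)
        fixed = trans (+-cong E-equation (-‿cong (⊛-congˡ Q F-equation)))
          (solve 5 (λ g e f pt pr → (con (1 , 0) :+ g :* e :+ (pr :+ (:- pt))) :+ (:- ((con (1 , 0) :+ (:- pt) :+ pr) :* (con (1 , 0) :+ g :* f)))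
                                    := g :* (e :+ (:- ((con (1 , 0) :+ (:- pt) :+ pr) :* f)))) refl G E F (P t) (P r))

    quadratic : z ⊛ Q ⊛ Q ⊛ F ⊛ F ⊖ B[ two ] ⊛ F ⊕ 1ₛ ≈ₛ 0ₛ
    quadratic = begin
      z ⊛ Q ⊛ Q ⊛ F ⊛ F ⊖ B[ two ] ⊛ F ⊕ 1ₛ
        ≈⟨ solve 5 (λ Z pt pr f g →
             let o = con (1 , 0)
                 q = o :+ (:- pt) :+ pr
                 b = o :+ Z :+ (:- ((o :+ Z) :* pt)) :+ con (2 , 0) :* Z :* pr
             in Z :* q :* q :* f :* f :+ (:- (b :* f)) :+ o
                := (Z :* q :* f :+ (:- o)) :* (f :+ (:- (o :+ g :* f)))
                  :+ (:- (f :* (g :+ (:- (Z :* (g :+ pr :+ (:- pt)) :* (q :* f) :+ pt :+ (:- (Z :* pr))))))))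
           refl z (P t) (P r) F G ⟩
      (z ⊛ Q ⊛ F ⊖ 1ₛ) ⊛ (F ⊖ (1ₛ ⊕ G ⊛ F)) ⊖ F ⊛ (G ⊖ (z ⊛ (G ⊕ P r ⊖ P t) ⊛ (Q ⊛ F) ⊕ P t ⊖ z ⊛ P r))
        ≈⟨ +-cong (⊛-congˡ (z ⊛ Q ⊛ F ⊖ 1ₛ) (≈⇒⊖≈0 F-equation)) (-‿cong (⊛-congˡ F (≈⇒⊖≈0 G-equation′))) ⟩
      (z ⊛ Q ⊛ F ⊖ 1ₛ) ⊛ 0ₛ ⊖ F ⊛ 0ₛ
        ≈⟨ solve 2 (λ a f → a :* con (0 , 0) :+ (:- (f :* con (0 , 0))) := con (0 , 0)) refl (z ⊛ Q ⊛ F ⊖ 1ₛ) F ⟩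
      0ₛ ∎
      where
        G-equation′ : G ≈ₛ z ⊛ (G ⊕ P r ⊖ P t) ⊛ (Q ⊛ F) ⊕ P t ⊖ z ⊛ P r
        G-equation′ = trans G-equation (⊖-congʳ (z ⊛ P r) (⊕-congʳ (P t) (⊛-congˡ (z ⊛ (G ⊕ P r ⊖ P t)) E≈QF)))

    K : Ser
    K = two ⊛ Q ⊛ Q ⊛ F

    sqrtΔ : Ser
    sqrtΔ = B[ two ] ⊖ z ⊛ K

    sqrtΔ² : sqrtΔ ⊛ sqrtΔ ≈ₛ Δ[ two ]
    sqrtΔ² = begin
      sqrtΔ ⊛ sqrtΔ
        ≈⟨ solve 4 (λ Z pt pr f →
             let o = con (1 , 0)
                 w = con (2 , 0)
                 q = o :+ (:- pt) :+ pr
                 b = o :+ Z :+ (:- ((o :+ Z) :* pt)) :+ w :* Z :* pr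
                 x = o :+ (:- pt) :+ w :* pr
                 s = b :+ (:- (Z :* (w :* q :* q :* f)))
                 d = (o :+ (:- Z)) :* ((o :+ (:- pt)) :* (o :+ (:- pt)) :+ (:- (Z :* x :* x)))
                 e = Z :* q :* q :* f :* f :+ (:- (b :* f)) :+ o
             in s :* s := d :+ Z :* q :* q :* ((e :+ e) :+ (e :+ e)))
           refl z (P t) (P r) F ⟩
      Δ[ two ] ⊕ z ⊛ Q ⊛ Q ⊛ ((e ⊕ e) ⊕ (e ⊕ e))
        ≈⟨ ⊕-congˡ Δ[ two ] (⊛-congˡ (z ⊛ Q ⊛ Q) (+-cong (+-cong quadratic quadratic) (+-cong quadratic quadratic))) ⟩
      Δ[ two ] ⊕ z ⊛ Q ⊛ Q ⊛ ((0ₛ ⊕ 0ₛ) ⊕ (0ₛ ⊕ 0ₛ))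
        ≈⟨ solve 2 (λ d a → d :+ a :* ((con (0 , 0) :+ con (0 , 0)) :+ (con (0 , 0) :+ con (0 , 0))) := d) refl Δ[ two ] (z ⊛ Q ⊛ Q) ⟩
      Δ[ two ] ∎
      where
        e : Ser
        e = z ⊛ Q ⊛ Q ⊛ F ⊛ F ⊖ B[ two ] ⊛ F ⊕ 1ₛ

    sqrtΔ₀ : sqrtΔ 0 ≈ 1#
    sqrtΔ₀ = R.trans (R.+-cong (R.+-cong (R.+-congˡ (R.-‿cong (R.trans (⊛-zero (1ₛ ⊕ z) (P t)) (R.zeroʳ _)))) (R.trans (⊛-zero (two ⊛ z) (P r)) (R.zeroʳ _)))
                              (R.-‿cong (z-⊛-zero K)))
                    (R.trans (x-0#≈x _) (R.trans (R.+-identityʳ _) (R.trans (x-0#≈x _) (R.+-identityʳ 1#))))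

    sqrtΔ≋sqrtS : sqrtΔ ≋ sqrtS h Δ[ const (1# + 1#) ]
    sqrtΔ≋sqrtS = SquareRoot.sqrtS-unique h 2h≈1 Δ[ const (1# + 1#) ] sqrtΔ sqrtΔ₀ (un (trans sqrtΔ² (sym (Δ-cong const2≈two))))

    numerator : B[ const (1# + 1#) ] ⊖ sqrtS h Δ[ const (1# + 1#) ] ≈ₛ z ⊛ K
    numerator = begin
      B[ const (1# + 1#) ] ⊖ sqrtS h Δ[ const (1# + 1#) ] ≈⟨ +-cong (B-cong const2≈two) (-‿cong (sym (mk sqrtΔ≋sqrtS))) ⟩
      B[ two ] ⊖ sqrtΔ                                      ≈⟨ solve 3 (λ b Z k → b :+ (:- (b :+ (:- (Z :* k)))) := Z :* k) refl B[ two ] z K ⟩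
      z ⊛ K                                                ∎

    h⊛two≈1 : const h ⊛ two ≈ₛ 1ₛ
    h⊛two≈1 = mk λ { zero    → R.trans (const-⊛ h two 0) (R.trans (R.*-comm _ _) 2h≈1)
                   ; (suc n) → R.trans (const-⊛ h two (suc n)) (R.trans (R.*-congˡ (R.+-identityʳ 0#)) (R.zeroʳ h)) }

    Q²₀ : (Q ⊛ Q) 0 ≈ 1#
    Q²₀ = R.trans (⊛-zero Q Q) (R.trans (R.*-cong Q₀ Q₀) (R.*-identityˡ 1#))
      where
        Q₀ : Q 0 ≈ 1#
        Q₀ = R.trans (R.+-identityʳ _) (x-0#≈x 1#)

    rhsGF≋F : rhsGF h t r ≋ F
    rhsGF≋F = un (begin
      const h ⊛ divZ (B[ const (1# + 1#) ] ⊖ sqrtS h Δ[ const (1# + 1#) ]) ⊛ inv (Q ⊛ Q)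
        ≈⟨ ⊛-congʳ (inv (Q ⊛ Q)) (⊛-congˡ (const h) (mk (λ n → R.trans (un numerator (suc n)) (divZ-z-⊛ K n)))) ⟩
      const h ⊛ K ⊛ inv (Q ⊛ Q)
        ≈⟨ solve 4 (λ H q f i → H :* (con (2 , 0) :* q :* q :* f) :* i := (H :* con (2 , 0)) :* f :* (q :* q :* i)) refl (const h) Q F (inv (Q ⊛ Q)) ⟩
      (const h ⊛ two) ⊛ F ⊛ (Q ⊛ Q ⊛ inv (Q ⊛ Q))
        ≈⟨ *-cong (⊛-congʳ F h⊛two≈1) (mk (inv-inverseʳ (Q ⊛ Q) Q²₀)) ⟩
      1ₛ ⊛ F ⊛ 1ₛ
        ≈⟨ trans (*-identityʳ _) (*-identityˡ F) ⟩
      F ∎)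

theorem2p4 : {c ℓ : Level} (R : CommutativeRing c ℓ) →
    let open CommutativeRing R in let open Series R in
    (h : Carrier) → (1# + 1#) * h ≈ 1# →
    (t r : ℕ → Carrier) →
    dyckGF t r ≋ rhsGF h t r
theorem2p4 R h 2h≈1 t r n = trans (dyckGF≋F n) (sym (rhsGF≋F h 2h≈1 F G E (z-⊛-zero A) F-equation E-equation G-equation n))
  where
    open CommutativeRing R using (trans; sym)
    open PowerSeries R using (z-⊛-zero)
    open WeightSeries R t r using (F; E; A; dyckGF≋F)
    open FunctionalEquations R t r using (G; F-equation; E-equation; G-equation)
    open ClosedForm R t r using (rhsGF≋F)
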